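{- Let $\lambda\vdash m$ be a partition of length $\ell$ and $(s,t)\in A(\lambda)\times A(\lambda')$. Then: (a) $G(s,t)$ is a double coset in $Y_s\backslash S_m/Y_t$. Moreover, if $h\in G(s,t)$ and $w=xhy$ with $x\in Y_s$, $y\in Y_t$, then $\mathrm{sgn}_s(wt)=\mathrm{sgn}(x)\cdot\mathrm{sgn}_s(ht)$. (b) $\mathrm{sgn}_s(t)\ne0\iff\mathrm{sgn}_t(s)\ne0\iff\{(s_i,t_i):i=1,\dots,m\}=D(\lambda)$, where $s=s_1\cdots s_m$, $t=t_1\cdots t_m$. (c) $\mathrm{sgn}_s(t)\ne0\iff\mathrm{sgn}_{hs}(ht)\ne0$ for every $h\in S_m$. (d) $G(s,t)^{ -1}=G(t,s)$. (e) The product $(-1)^{G(s,t)}:=\mathrm{sgn}_s(\pi t)\cdot(-1)^\pi\cdot\mathrm{sgn}_t(\pi^{ -1}s)$ does not depend on the choice of $\pi\in G(s,t)$. (f) The product $f(s,t):=(-1)^s\,(-1)^{G(s,t)}\,(-1)^t$ does not depend on the pair $(s,t)$ but only on $\lambda$, and equals $(-1)^\lambda$.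
   Context: For a sequence $\alpha$ of nonnegative integers with sum $m$, $A(\alpha)$ is the set of words of length $m$ in which letter $i$ occurs $\alpha_i$ times. $S_m$ acts on words of length $m$ by permuting positions: $(\pi w)_j=w_{\pi^{ -1}(j)}$. For a word $w$, $Y_w\subseteq S_m$ is its stabilizer (a Young subgroup). $(-1)^\pi$ is the sign of $\pi\in S_m$. For a word $w$, $(-1)^w=(-1)^{\#\{i<j:w_i>w_j\}}$. For a partition $\lambda=(\lambda_1,\dots,\lambda_\ell)$, $\lambda'$ is its conjugate, $D(\lambda)=\{(i,j):1\le i\le\ell,1\le j\le\lambda_i\}$ its Young diagram, and $(-1)^\lambda=(-1)^w$ for $w=12\cdots\lambda_1\,12\cdots\lambda_2\cdots12\cdots\lambda_\ell$. For words $s,x$ of length $m$ (positive integer letters), $\mathrm{sgn}_s(x)=\prod_c\mathrm{sgn}(x_{b_1},\dots,x_{b_k})$, the product over letters $c$ occurring in $s$, with $b_1<\dots<b_k$ the positions of $c$ in $s$, where $\mathrm{sgn}(a_1,\dots,a_k)$ is the sign of the permutation $(a_1,\dots,a_k)$ if it is a permutation of $[k]$ and $0$ otherwise. $G(s,t)=\{w\in S_m:\mathrm{sgn}_s(wt)\ne0\}$. -}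

module Defs where

open import Data.Nat as ℕ using (ℕ; zero; suc; _≤_; _<?_; _≤?_; _≟_)
open import Data.Integer as ℤ using (ℤ; +_; -_)
open import Data.Fin using (Fin; toℕ)
open import Data.List using (List; []; _∷_; map; filter; length; allFin; upTo; foldr; concatMap; deduplicate)
open import Data.Nat.ListAction using (sum)
open import Data.List.Relation.Unary.All using (All)
open import Data.List.Relation.Unary.Linked using (Linked)
open import Data.Bool using (Bool; true; false; if_then_else_; _∧_)
open import Data.Product using (_×_; Σ; ∃)
open import Relation.Nullary.Decidable using (⌊_⌋)
open import Relation.Binary.PropositionalEquality using (_≡_; _≢_)
open import Data.Fin.Permutation using (Permutation′; _⟨$⟩ʳ_; _⟨$⟩ˡ_; _∘ₚ_; flip)

neg1^ : ℕ → ℤ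
neg1^ zero    = + 1
neg1^ (suc n) = - neg1^ n

inv : List ℕ → ℕ
inv []       = 0
inv (a ∷ as) = length (filter (λ b → b <? a) as) ℕ.+ inv as

prodℤ : List ℤ → ℤ
prodℤ = foldr ℤ._*_ (+ 1)

oneTo : ℕ → List ℕ
oneTo k = map suc (upTo k)

occ : ℕ → List ℕ → ℕ
occ v as = length (filter (λ b → b ≟ v) as)

isPermOf[k] : List ℕ → Bool
isPermOf[k] as = foldr _∧_ true (map (λ v → ⌊ occ v as ≟ 1 ⌋) (oneTo (length as)))

seqSgn : List ℕ → ℤ
seqSgn as = if isPermOf[k] as then neg1^ (inv as) else + 0

Word : ℕ → Set
Word m = Fin m → ℕ

wordList : ∀ {m} → Word m → List ℕ
wordList {m} w = map w (allFin m)

signWord : ∀ {m} → Word m → ℤ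
signWord w = neg1^ (inv (wordList w))

Perm : ℕ → Set
Perm m = Permutation′ m

-- product σ · τ = σ ∘ τ (apply τ first)
_·_ : ∀ {m} → Perm m → Perm m → Perm m
σ · τ = τ ∘ₚ σ

_⁻¹ : ∀ {m} → Perm m → Perm m
π ⁻¹ = flip π

_≈ₚ_ : ∀ {m} → Perm m → Perm m → Set
σ ≈ₚ τ = ∀ i → σ ⟨$⟩ʳ i ≡ τ ⟨$⟩ʳ i

signPerm : ∀ {m} → Perm m → ℤ
signPerm {m} π = neg1^ (inv (map (λ i → toℕ (π ⟨$⟩ʳ i)) (allFin m)))

act : ∀ {m} → Perm m → Word m → Word m
act π w j = w (π ⟨$⟩ˡ j)

InY : ∀ {m} → Word m → Perm m → Set
InY w π = ∀ j → act π w j ≡ w j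

-- α_i (0-indexed lookup, 0 outside the list)
part : List ℕ → ℕ → ℕ
part []      _       = 0
part (a ∷ α) zero    = a
part (a ∷ α) (suc i) = part α i

-- multiplicity of letter c in the composition α (letters are 1,2,...)
letterMult : List ℕ → ℕ → ℕ
letterMult α zero    = 0
letterMult α (suc i) = part α i

positions : ∀ {m} → Word m → ℕ → List (Fin m)
positions {m} w c = filter (λ j → w j ≟ c) (allFin m)

count : ∀ {m} → Word m → ℕ → ℕ
count w c = length (positions w c)

InA : ∀ {m} → List ℕ → Word m → Set
InA α w = ∀ c → count w c ≡ letterMult α c

IsPartition : ℕ → List ℕ → Set
IsPartition m λ′ = (sum λ′ ≡ m) × All (1 ≤_) λ′ × Linked ℕ._≥_ λ′

firstPart : List ℕ → ℕ
firstPart []      = 0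
firstPart (a ∷ _) = a

conj : List ℕ → List ℕ
conj λ′ = map (λ j → length (filter (λ x → j ≤? x) λ′)) (oneTo (firstPart λ′))

InD : List ℕ → ℕ → ℕ → Set
InD λ′ i j = (1 ≤ i) × (i ≤ length λ′) × (1 ≤ j) × (j ≤ letterMult λ′ i)

signPartition : List ℕ → ℤ
signPartition λ′ = neg1^ (inv (concatMap oneTo λ′))

letters : ∀ {m} → Word m → List ℕ
letters s = deduplicate _≟_ (wordList s)

sgnS : ∀ {m} → Word m → Word m → ℤ
sgnS s x = prodℤ (map (λ c → seqSgn (map x (positions s c))) (letters s))

InG : ∀ {m} → Word m → Word m → Perm m → Set
InG s t w = sgnS s (act w t) ≢ + 0

signG : ∀ {m} → Word m → Word m → Perm m → ℤ
signG s t π = sgnS s (act π t) ℤ.* signPerm π ℤ.* sgnS t (act (π ⁻¹) s)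

-- sgn_s(x) ≠ 0 says that each pair (c, v) with 1 ≤ v ≤ #c in s occurs exactly once among the (s i, x i). For
-- (s, t) ∈ A(λ) × A(λ′) this means that the pairs (s i, t i) are the cells of D(λ): a condition symmetric in s and t
-- and invariant under relabelling positions, which gives (b), (c) and (d), and also (a), since two pairs of words
-- with the same pairs differ by a permutation.
--
-- Every sign involved is (-1) to an inversion number, a double sum over positions. For a tournament g on the
-- positions and a permutation ρ, the arcs of g that ρ orders increasingly plus the inversions of ρ have the parity
-- of the arcs of g going forward. For the tournament of the lexicographic order of the pairs (s i, x i) this gives
-- the sign rule in (a), and shows that f(s,t) = (-1)^Φ(s, πt) with Φ unchanged mod 2 under relabelling. At the
-- canonical pair, listing row and column of the cells of D(λ) read row by row, Φ is the inversion number of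
-- 12…λ₁ 12…λ₂ ⋯, so f = (-1)^λ, and (e) follows from (f).

module Submission where

open import Defs
open import Data.Bool using (Bool; true; false; not; _∧_; _∨_; T)
open import Data.Bool.Properties using (∧-comm; ∧-assoc; ∧-zeroʳ; T-∧; T-≡)
open import Data.Empty using (⊥-elim)
open import Data.Fin as F using (Fin; toℕ)
import Data.Fin.Properties as FP
open import Data.Fin.Permutation as P using (_⟨$⟩ʳ_; _⟨$⟩ˡ_; inverseʳ; inverseˡ; flip; lift₀; transpose; _∘ₚ_)
open import Data.Integer using (ℤ; +_; -_; _*_)
import Data.Integer.Properties as ℤP
import Data.Integer.Solver as ℤS
open import Data.List using (List; []; _∷_; _++_; map; filter; length; tabulate; allFin; upTo; applyUpTo; lookup; concatMap)
import Data.List.Properties as LP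
open import Data.List.Membership.Propositional using (_∈_)
import Data.List.Membership.Propositional.Properties as MP
open import Data.List.Relation.Unary.All as All using (All; []; _∷_)
import Data.List.Relation.Unary.All.Properties as AllP
open import Data.List.Relation.Unary.AllPairs using (AllPairs; []; _∷_)
import Data.List.Relation.Unary.AllPairs.Properties as AllPairsP
open import Data.List.Relation.Unary.Any as Any using (here; there)
import Data.List.Relation.Unary.Any.Properties as AnyP
open import Data.List.Relation.Unary.Linked as Linked using (Linked)
import Data.List.Relation.Unary.Linked.Properties as LinkedP
open import Data.List.Relation.Unary.Unique.Propositional using (Unique)
import Data.List.Relation.Unary.Unique.DecPropositional.Properties as UP
open import Data.Nat as ℕ using (ℕ; zero; suc; _≤_; _<_; _≥_; _<?_; _≤?_; _≟_; z≤n; s≤s)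
import Data.Nat.Properties as ℕP
open import Data.Nat.ListAction using () renaming (sum to ∑ˡ)
import Data.Nat.ListAction.Properties as ListActionP
open import Data.Nat.Solver using (module +-*-Solver)
open import Data.Product using (_×_; Σ; ∃; _,_; proj₁; proj₂)
open import Data.Sum using (_⊎_; inj₁; inj₂)
open import Data.Unit using (tt)
open import Function using (_∘_)
open import Function.Bundles using (_⇔_; mk⇔; module Equivalence)
import Function.Properties.Equivalence as ⇔
open import Level using (0ℓ)
open import Relation.Binary using (tri<; tri≈; tri>; DecidableEquality)
open import Relation.Binary.PropositionalEquality
open import Relation.Nullary using (Dec; yes; no; ¬_; does)
open import Relation.Nullary.Decidable using (dec-true; dec-false; map′; _×-dec_; toWitness; fromWitness)
open import Relation.Unary using (Pred; Decidable)
open import Algebra.Properties.CommutativeMonoid.Sum ℕP.+-0-commutativeMonoid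
  using (sum; ∑-distrib-+; ∑-comm; ∑-permute; sum-cong-≗; sum-replicate-zero)

-- Signs and parity

neg1^-+ : ∀ a b → neg1^ (a ℕ.+ b) ≡ neg1^ a * neg1^ b
neg1^-+ zero    b = sym (ℤP.*-identityˡ (neg1^ b))
neg1^-+ (suc a) b = trans (cong -_ (neg1^-+ a b)) (ℤP.neg-distribˡ-* (neg1^ a) (neg1^ b))

neg1^-*-self : ∀ a → neg1^ a * neg1^ a ≡ + 1
neg1^-*-self zero    = refl
neg1^-*-self (suc a) = begin
  - neg1^ a * - neg1^ a   ≡⟨ sym (ℤP.neg-distribˡ-* (neg1^ a) (- neg1^ a)) ⟩
  - (neg1^ a * - neg1^ a) ≡⟨ cong -_ (sym (ℤP.neg-distribʳ-* (neg1^ a) (neg1^ a))) ⟩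
  - - (neg1^ a * neg1^ a) ≡⟨ ℤP.neg-involutive _ ⟩
  neg1^ a * neg1^ a       ≡⟨ neg1^-*-self a ⟩
  + 1                     ∎
  where open ≡-Reasoning

neg1^≢0 : ∀ a → neg1^ a ≢ + 0
neg1^≢0 zero    ()
neg1^≢0 (suc a) eq = neg1^≢0 a (trans (sym (ℤP.neg-involutive (neg1^ a))) (cong -_ eq))

infix 4 _≡₂_

record _≡₂_ (a b : ℕ) : Set where
  constructor parity
  field neg1^-≡ : neg1^ a ≡ neg1^ b
open _≡₂_ public

≡₂-reflexive : ∀ {a b} → a ≡ b → a ≡₂ b
≡₂-reflexive eq = parity (cong neg1^ eq)

≡₂-refl : ∀ {a} → a ≡₂ a
≡₂-refl = parity refl

≡₂-sym : ∀ {a b} → a ≡₂ b → b ≡₂ a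
≡₂-sym (parity p) = parity (sym p)

≡₂-trans : ∀ {a b c} → a ≡₂ b → b ≡₂ c → a ≡₂ c
≡₂-trans (parity p) (parity q) = parity (trans p q)

+-cong-≡₂ : ∀ {a a′ b b′} → a ≡₂ a′ → b ≡₂ b′ → a ℕ.+ b ≡₂ a′ ℕ.+ b′
+-cong-≡₂ {a} {a′} {b} {b′} (parity p) (parity q) =
  parity (trans (neg1^-+ a b) (trans (cong₂ _*_ p q) (sym (neg1^-+ a′ b′))))

n+n≡₂0 : ∀ n → n ℕ.+ n ≡₂ 0
n+n≡₂0 n = parity (trans (neg1^-+ n n) (neg1^-*-self n))

neg1^-split : ∀ a b c → a ℕ.+ b ≡₂ c → neg1^ a ≡ neg1^ b * neg1^ c
neg1^-split a b c (parity p) = begin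
  neg1^ a                       ≡⟨ sym (ℤP.*-identityʳ _) ⟩
  neg1^ a * + 1                 ≡⟨ cong (neg1^ a *_) (sym (neg1^-*-self b)) ⟩
  neg1^ a * (neg1^ b * neg1^ b) ≡⟨ sym (ℤP.*-assoc (neg1^ a) _ _) ⟩
  (neg1^ a * neg1^ b) * neg1^ b ≡⟨ cong (_* neg1^ b) (trans (sym (neg1^-+ a b)) p) ⟩
  neg1^ c * neg1^ b             ≡⟨ ℤP.*-comm (neg1^ c) _ ⟩
  neg1^ b * neg1^ c             ∎
  where open ≡-Reasoning

+-cancelˡ-≡₂ : ∀ c {a b} → c ℕ.+ a ≡₂ c ℕ.+ b → a ≡₂ b
+-cancelˡ-≡₂ c {a} {b} p = parity (begin
  neg1^ a                       ≡⟨ neg1^-split a c (c ℕ.+ b) (≡₂-trans (≡₂-reflexive (ℕP.+-comm a c)) p) ⟩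
  neg1^ c * neg1^ (c ℕ.+ b)     ≡⟨ cong (neg1^ c *_) (neg1^-+ c b) ⟩
  neg1^ c * (neg1^ c * neg1^ b) ≡⟨ sym (ℤP.*-assoc (neg1^ c) _ _) ⟩
  neg1^ c * neg1^ c * neg1^ b   ≡⟨ cong (_* neg1^ b) (neg1^-*-self c) ⟩
  + 1 * neg1^ b                 ≡⟨ ℤP.*-identityˡ _ ⟩
  neg1^ b                       ∎)
  where open ≡-Reasoning

cancel-involutions : ∀ a b x y → a * a ≡ + 1 → b * b ≡ + 1 → a * x * b ≡ a * y * b → x ≡ y
cancel-involutions a b x y aa bb eq = trans (sym (unwrap x)) (trans (cong (λ z → a * z * b) eq) (unwrap y))
  where
  open ℤS.+-*-Solver
  regroup : ∀ a b x → a * (a * x * b) * b ≡ (a * a) * x * (b * b)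
  regroup = solve 3 (λ a b x → a :* (a :* x :* b) :* b := (a :* a) :* x :* (b :* b)) refl
  unwrap : ∀ x → a * (a * x * b) * b ≡ x
  unwrap x = trans (regroup a b x)
    (trans (cong₂ (λ p q → p * x * q) aa bb) (trans (ℤP.*-identityʳ _) (ℤP.*-identityˡ x)))

-- Sums over Fin

𝟙 : Bool → ℕ
𝟙 true  = 1
𝟙 false = 0

does-true⇒ : ∀ {P : Set} (d : Dec P) → does d ≡ true → P
does-true⇒ (yes p) _ = p

𝟙-does⇒ : ∀ {P : Set} (d : Dec P) → 1 ≤ 𝟙 (does d) → P
𝟙-does⇒ (yes p) _ = p

∑∑ : ∀ {n} → (Fin n → Fin n → ℕ) → ℕ
∑∑ F = sum (λ k → sum (F k))

sum-cong-≡₂ : ∀ {n} (f g : Fin n → ℕ) → (∀ i → f i ≡₂ g i) → sum f ≡₂ sum g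
sum-cong-≡₂ {zero}  f g p = ≡₂-refl
sum-cong-≡₂ {suc n} f g p = +-cong-≡₂ (p F.zero) (sum-cong-≡₂ (f ∘ F.suc) (g ∘ F.suc) (p ∘ F.suc))

∑∑-+ : ∀ {n} (F G : Fin n → Fin n → ℕ) → ∑∑ (λ k l → F k l ℕ.+ G k l) ≡ ∑∑ F ℕ.+ ∑∑ G
∑∑-+ {n} F G = trans (sum-cong-≗ {n} (λ k → ∑-distrib-+ (F k) (G k))) (∑-distrib-+ (λ k → sum (F k)) (λ k → sum (G k)))

∑∑-zero : ∀ {n} (F : Fin n → Fin n → ℕ) → (∀ k l → F k l ≡ 0) → ∑∑ F ≡ 0
∑∑-zero {n} F h = trans (sum-cong-≗ {n} (λ k → trans (sum-cong-≗ {n} (h k)) (sum-replicate-zero n))) (sum-replicate-zero n)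

∑∑-peel : ∀ {n} (H : Fin (suc n) → Fin (suc n) → ℕ) →
  ∑∑ H ≡ (H F.zero F.zero ℕ.+ sum (λ j → H F.zero (F.suc j) ℕ.+ H (F.suc j) F.zero)) ℕ.+ ∑∑ (λ i j → H (F.suc i) (F.suc j))
∑∑-peel {n} H = begin
  (H₀₀ ℕ.+ row) ℕ.+ sum (λ i → H (F.suc i) F.zero ℕ.+ sum (λ j → H (F.suc i) (F.suc j)))
    ≡⟨ cong ((H₀₀ ℕ.+ row) ℕ.+_) (∑-distrib-+ (λ i → H (F.suc i) F.zero) (λ i → sum (λ j → H (F.suc i) (F.suc j)))) ⟩
  (H₀₀ ℕ.+ row) ℕ.+ (col ℕ.+ rest)
    ≡⟨ solve 4 (λ a b c d → (a :+ b) :+ (c :+ d) := (a :+ (b :+ c)) :+ d) refl H₀₀ row col rest ⟩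
  (H₀₀ ℕ.+ (row ℕ.+ col)) ℕ.+ rest
    ≡⟨ cong (λ z → (H₀₀ ℕ.+ z) ℕ.+ rest) (sym (∑-distrib-+ (λ j → H F.zero (F.suc j)) (λ j → H (F.suc j) F.zero))) ⟩
  (H₀₀ ℕ.+ sum (λ j → H F.zero (F.suc j) ℕ.+ H (F.suc j) F.zero)) ℕ.+ rest ∎
  where
  open ≡-Reasoning
  open +-*-Solver
  H₀₀ row col rest : ℕ
  H₀₀ = H F.zero F.zero
  row = sum (λ j → H F.zero (F.suc j))
  col = sum (λ i → H (F.suc i) F.zero)
  rest = ∑∑ (λ i j → H (F.suc i) (F.suc j))

∑∑-peelUpper : ∀ {n} (H : Fin (suc n) → Fin (suc n) → ℕ) → H F.zero F.zero ≡ 0 → (∀ i → H (F.suc i) F.zero ≡ 0) →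
  ∑∑ H ≡ sum (λ j → H F.zero (F.suc j)) ℕ.+ ∑∑ (λ i j → H (F.suc i) (F.suc j))
∑∑-peelUpper {n} H H₀₀≡0 Hᵢ₀≡0 = cong₂ ℕ._+_ (cong (ℕ._+ sum (λ j → H F.zero (F.suc j))) H₀₀≡0)
  (sum-cong-≗ {n} (λ i → cong (ℕ._+ sum (λ j → H (F.suc i) (F.suc j))) (Hᵢ₀≡0 i)))

∑∑-≡₂-symmetrised : ∀ {n} (F G : Fin n → Fin n → ℕ) →
  (∀ k l → F k l ℕ.+ F l k ≡₂ G k l ℕ.+ G l k) → (∀ k → F k k ≡₂ G k k) → ∑∑ F ≡₂ ∑∑ G
∑∑-≡₂-symmetrised {zero}  F G sym≡ diag≡ = ≡₂-refl
∑∑-≡₂-symmetrised {suc n} F G sym≡ diag≡ =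
  ≡₂-trans (≡₂-reflexive (∑∑-peel F))
  (≡₂-trans (+-cong-≡₂ (+-cong-≡₂ (diag≡ F.zero) (sum-cong-≡₂ _ _ (λ j → sym≡ F.zero (F.suc j))))
                        (∑∑-≡₂-symmetrised (λ i j → F (F.suc i) (F.suc j)) (λ i j → G (F.suc i) (F.suc j))
                                            (λ k l → sym≡ (F.suc k) (F.suc l)) (λ k → diag≡ (F.suc k))))
            (≡₂-reflexive (sym (∑∑-peel G))))

sum-mono : ∀ {n} {f g : Fin n → ℕ} → (∀ i → f i ≤ g i) → sum f ≤ sum g
sum-mono {zero}  f≤g = z≤n
sum-mono {suc n} f≤g = ℕP.+-mono-≤ (f≤g F.zero) (sum-mono (f≤g ∘ F.suc))

sum-𝟙-≟ : ∀ {n} (i : Fin n) → sum (λ k → 𝟙 (does (k FP.≟ i))) ≡ 1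
sum-𝟙-≟ {suc n} F.zero = cong suc (trans (sum-cong-≗ {n} (λ k → cong 𝟙 (dec-false (F.suc k FP.≟ F.zero) (λ ())))) (sum-replicate-zero n))
sum-𝟙-≟ {suc n} (F.suc i) =
  trans (cong (λ b → 𝟙 b ℕ.+ sum (λ k → 𝟙 (does (F.suc k FP.≟ F.suc i)))) (dec-false (F.zero FP.≟ F.suc i) (λ ())))
                                  (sum-𝟙-≟ i)

sum-ones : ∀ n → sum {n} (λ _ → 1) ≡ n
sum-ones zero    = refl
sum-ones (suc n) = cong suc (sum-ones n)

sum-pos⇒term-pos : ∀ {n} (f : Fin n → ℕ) → 1 ≤ sum f → ∃ λ i → 1 ≤ f i
sum-pos⇒term-pos {suc n} f pos with f F.zero in eq
... | suc _ = F.zero , subst (1 ≤_) (sym eq) (s≤s z≤n)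
... | zero with sum-pos⇒term-pos (f ∘ F.suc) pos
...   | i , fᵢ-pos = F.suc i , fᵢ-pos

term-pos⇒sum-pos : ∀ {n} (f : Fin n → ℕ) i → 1 ≤ f i → 1 ≤ sum f
term-pos⇒sum-pos f i fᵢ-pos = ℕP.≤-trans (ℕP.≤-reflexive (sym (sum-𝟙-≟ i))) (sum-mono δ≤f)
  where
  δ≤f : ∀ k → 𝟙 (does (k FP.≟ i)) ≤ f k
  δ≤f k with k FP.≟ i
  ... | yes refl = fᵢ-pos
  ... | no _     = z≤n

sum≡0⇒term≡0 : ∀ {n} (f : Fin n → ℕ) → sum f ≡ 0 → ∀ i → f i ≡ 0
sum≡0⇒term≡0 f sum≡0 i with f i in eq
... | zero  = refl
... | suc _ with subst (1 ≤_) sum≡0 (term-pos⇒sum-pos f i (subst (1 ≤_) (sym eq) (s≤s z≤n)))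
...   | ()

two-terms-pos⇒sum≥2 : ∀ {n} (f : Fin n → ℕ) i j → i ≢ j → 1 ≤ f i → 1 ≤ f j → 2 ≤ sum f
two-terms-pos⇒sum≥2 {n} f i j i≢j fᵢ-pos fⱼ-pos = subst (_≤ sum f) two (sum-mono δδ≤f)
  where
  two : sum (λ k → 𝟙 (does (k FP.≟ i)) ℕ.+ 𝟙 (does (k FP.≟ j))) ≡ 2
  two = trans (∑-distrib-+ (λ k → 𝟙 (does (k FP.≟ i))) (λ k → 𝟙 (does (k FP.≟ j)))) (cong₂ ℕ._+_ (sum-𝟙-≟ i) (sum-𝟙-≟ j))
  δδ≤f : ∀ k → 𝟙 (does (k FP.≟ i)) ℕ.+ 𝟙 (does (k FP.≟ j)) ≤ f k
  δδ≤f k with k FP.≟ i | k FP.≟ j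
  ... | yes refl | yes refl = ⊥-elim (i≢j refl)
  ... | yes refl | no _     = fᵢ-pos
  ... | no _     | yes refl = fⱼ-pos
  ... | no _     | no _     = z≤n

terms-pos∧sum≤n⇒terms≡1 : ∀ {n} (f : Fin n → ℕ) → (∀ j → 1 ≤ f j) → sum f ≤ n → ∀ j → f j ≡ 1
terms-pos∧sum≤n⇒terms≡1 {suc n} f pos sum≤ F.zero = ℕP.≤-antisym
  (ℕP.+-cancelʳ-≤ n (f F.zero) 1
    (ℕP.≤-trans (ℕP.+-monoʳ-≤ (f F.zero) (subst (_≤ sum (f ∘ F.suc)) (sum-ones n) (sum-mono (pos ∘ F.suc)))) sum≤))
  (pos F.zero)
terms-pos∧sum≤n⇒terms≡1 {suc n} f pos sum≤ (F.suc j) = terms-pos∧sum≤n⇒terms≡1 (f ∘ F.suc) (pos ∘ F.suc)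
  (ℕP.+-cancelˡ-≤ 1 _ _ (ℕP.≤-trans (ℕP.+-monoˡ-≤ (sum (f ∘ F.suc)) (pos F.zero)) sum≤)) j

sum-𝟙-≟-shift : ∀ k o y → sum {k} (λ j → 𝟙 (does (y ≟ o ℕ.+ toℕ j))) ≡ 𝟙 (does (o ≤? y) ∧ does (y <? o ℕ.+ k))
sum-𝟙-≟-shift zero o y = empty (o ≤? y)
  where
  empty : (o≤?y : Dec (o ≤ y)) → 0 ≡ 𝟙 (does o≤?y ∧ does (y <? o ℕ.+ 0))
  empty (no _)    = refl
  empty (yes o≤y) = cong (λ b → 𝟙 (true ∧ b)) (sym (dec-false (y <? o ℕ.+ 0) (ℕP.≤⇒≯ (subst (_≤ y) (sym (ℕP.+-identityʳ o)) o≤y))))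
sum-𝟙-≟-shift (suc k) o y = trans (cong (𝟙 (does (y ≟ o ℕ.+ 0)) ℕ.+_)
    (trans (sum-cong-≗ {k} (λ j → cong (λ z → 𝟙 (does (y ≟ z))) (ℕP.+-suc o (toℕ j)))) (sum-𝟙-≟-shift k (suc o) y)))
  step
  where
  𝟙∧≡ : ∀ {a b a′ b′} → a ≡ a′ → b ≡ b′ → 𝟙 (a ∧ b) ≡ 𝟙 (a′ ∧ b′)
  𝟙∧≡ = cong₂ (λ a b → 𝟙 (a ∧ b))
  step : 𝟙 (does (y ≟ o ℕ.+ 0)) ℕ.+ 𝟙 (does (suc o ≤? y) ∧ does (y <? suc o ℕ.+ k)) ≡ 𝟙 (does (o ≤? y) ∧ does (y <? o ℕ.+ suc k))
  step with ℕP.<-cmp y o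
  ... | tri< y<o _ _ = trans
    (cong₂ ℕ._+_ (cong 𝟙 (dec-false (y ≟ o ℕ.+ 0) (λ e → ℕP.<-irrefl (trans e (ℕP.+-identityʳ o)) y<o)))
                 (𝟙∧≡ (dec-false (suc o ≤? y) (ℕP.<-asym y<o)) refl))
    (sym (𝟙∧≡ (dec-false (o ≤? y) (ℕP.<⇒≱ y<o)) refl))
  ... | tri≈ _ refl _ = trans
    (cong₂ ℕ._+_ (cong 𝟙 (dec-true (y ≟ y ℕ.+ 0) (sym (ℕP.+-identityʳ y))))
                 (𝟙∧≡ (dec-false (suc y ≤? y) (ℕP.<-irrefl refl)) refl))
    (sym (𝟙∧≡ (dec-true (y ≤? y) ℕP.≤-refl) (dec-true (y <? y ℕ.+ suc k) (subst (y <_) (sym (ℕP.+-suc y k)) (s≤s (ℕP.m≤m+n y k))))))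
  ... | tri> _ _ o<y = trans
    (cong₂ ℕ._+_ (cong 𝟙 (dec-false (y ≟ o ℕ.+ 0) (λ e → ℕP.<-irrefl (sym (trans e (ℕP.+-identityʳ o))) o<y)))
                 (𝟙∧≡ (dec-true (suc o ≤? y) o<y) refl))
    (sym (𝟙∧≡ (dec-true (o ≤? y) (ℕP.<⇒≤ o<y)) (cong (λ z → does (y <? z)) (ℕP.+-suc o k))))

-- Tournaments and the parity of their ascending arcs

-- Opaque, so that goals show i <ᵇ j rather than its normal form, which with and rewrite cannot abstract.
opaque
  _<ᵇ_ : ∀ {n} → Fin n → Fin n → Bool
  i <ᵇ j = does (toℕ i <? toℕ j)

  <ᵇ-unfold : ∀ {n} (i j : Fin n) → i <ᵇ j ≡ does (toℕ i <? toℕ j)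
  <ᵇ-unfold i j = refl

  <ᵇ-irrefl : ∀ {n} (i : Fin n) → i <ᵇ i ≡ false
  <ᵇ-irrefl i = dec-false (toℕ i <? toℕ i) (ℕP.<-irrefl refl)

  <ᵇ-flip : ∀ {n} (i j : Fin n) → i ≢ j → j <ᵇ i ≡ not (i <ᵇ j)
  <ᵇ-flip i j i≢j with ℕP.<-cmp (toℕ i) (toℕ j)
  ... | tri< i<j _ _ = trans (dec-false (toℕ j <? toℕ i) (ℕP.<-asym i<j)) (cong not (sym (dec-true (toℕ i <? toℕ j) i<j)))
  ... | tri≈ _ i≡j _ = ⊥-elim (i≢j (FP.toℕ-injective i≡j))
  ... | tri> _ _ j<i = trans (dec-true (toℕ j <? toℕ i) j<i) (cong not (sym (dec-false (toℕ i <? toℕ j) (ℕP.<-asym j<i))))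

  <ᵇ⇒< : ∀ {n} (i j : Fin n) → i <ᵇ j ≡ true → toℕ i < toℕ j
  <ᵇ⇒< i j = does-true⇒ (toℕ i <? toℕ j)

  0<ᵇsuc : ∀ {n} (j : Fin n) → F.zero <ᵇ F.suc j ≡ true
  0<ᵇsuc j = refl

  suc<ᵇ0 : ∀ {n} (i : Fin n) → F.suc i <ᵇ F.zero ≡ false
  suc<ᵇ0 i = refl

  suc<ᵇsuc : ∀ {n} (i j : Fin n) → F.suc i <ᵇ F.suc j ≡ i <ᵇ j
  suc<ᵇsuc i j = refl

⟨$⟩ʳ-injective : ∀ {n} (ρ : Perm n) {k l} → ρ ⟨$⟩ʳ k ≡ ρ ⟨$⟩ʳ l → k ≡ l
⟨$⟩ʳ-injective ρ {k} {l} eq = trans (sym (inverseˡ ρ)) (trans (cong (ρ ⟨$⟩ˡ_) eq) (inverseˡ ρ))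

IsTournament : ∀ {n} → (Fin n → Fin n → Bool) → Set
IsTournament g = ∀ k l → k ≢ l → g l k ≡ not (g k l)

forwardArcs : ∀ {n} → (Fin n → Fin n → Bool) → ℕ
forwardArcs g = ∑∑ (λ k l → 𝟙 (k <ᵇ l ∧ g k l))

ascendingArcs : ∀ {n} → Perm n → (Fin n → Fin n → Bool) → ℕ
ascendingArcs ρ g = ∑∑ (λ k l → 𝟙 ((ρ ⟨$⟩ʳ k) <ᵇ (ρ ⟨$⟩ʳ l) ∧ g k l))

-- Each unordered pair {k, l} carries one arc of g, one arc of the reversed order, and the parities of the
-- two sides agree pairwise by a truth table in (ρ k < ρ l, k < l, g k l).
ascendingArcs-≡₂ : ∀ {n} (ρ : Perm n) (g : Fin n → Fin n → Bool) → IsTournament g →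
  ascendingArcs ρ g ℕ.+ ascendingArcs ρ (λ k l → l <ᵇ k) ≡₂ forwardArcs g
ascendingArcs-≡₂ {n} ρ g g-flip =
  ≡₂-trans (≡₂-reflexive (sym (∑∑-+ A B))) (∑∑-≡₂-symmetrised (λ k l → A k l ℕ.+ B k l) C pairs diagonal)
  where
  A B C : Fin n → Fin n → ℕ
  A k l = 𝟙 ((ρ ⟨$⟩ʳ k) <ᵇ (ρ ⟨$⟩ʳ l) ∧ g k l)
  B k l = 𝟙 ((ρ ⟨$⟩ʳ k) <ᵇ (ρ ⟨$⟩ʳ l) ∧ l <ᵇ k)
  C k l = 𝟙 (k <ᵇ l ∧ g k l)

  truthTable : ∀ a b c → (𝟙 (a ∧ c) ℕ.+ 𝟙 (a ∧ not b)) ℕ.+ (𝟙 (not a ∧ not c) ℕ.+ 𝟙 (not a ∧ b))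
                         ≡₂ 𝟙 (b ∧ c) ℕ.+ 𝟙 (not b ∧ not c)
  truthTable true  true  true  = parity refl
  truthTable true  true  false = parity refl
  truthTable true  false true  = parity refl
  truthTable true  false false = parity refl
  truthTable false true  true  = parity refl
  truthTable false true  false = parity refl
  truthTable false false true  = parity refl
  truthTable false false false = parity refl

  oppositePair : ∀ {a a′ b b′ c c′} → a′ ≡ not a → b′ ≡ not b → c′ ≡ not c →
    (𝟙 (a ∧ c) ℕ.+ 𝟙 (a ∧ b′)) ℕ.+ (𝟙 (a′ ∧ c′) ℕ.+ 𝟙 (a′ ∧ b)) ≡₂ 𝟙 (b ∧ c) ℕ.+ 𝟙 (b′ ∧ c′)
  oppositePair {a} {b = b} {c = c} refl refl refl = truthTable a b c

  pairs : ∀ k l → (A k l ℕ.+ B k l) ℕ.+ (A l k ℕ.+ B l k) ≡₂ C k l ℕ.+ C l k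
  pairs k l with k FP.≟ l
  ... | yes refl = ≡₂-trans (n+n≡₂0 (A k k ℕ.+ B k k)) (≡₂-sym (n+n≡₂0 (C k k)))
  ... | no k≢l   = oppositePair (<ᵇ-flip (ρ ⟨$⟩ʳ k) (ρ ⟨$⟩ʳ l) (k≢l ∘ ⟨$⟩ʳ-injective ρ)) (<ᵇ-flip k l k≢l) (g-flip k l k≢l)

  diagonal : ∀ k → A k k ℕ.+ B k k ≡₂ C k k
  diagonal k rewrite <ᵇ-irrefl (ρ ⟨$⟩ʳ k) | <ᵇ-irrefl k = ≡₂-refl

-- Inversion numbers as double sums

∑∑-<ᵇ-peelUpper : ∀ {n} (G : Fin (suc n) → Fin (suc n) → Bool) →
  ∑∑ (λ i j → 𝟙 (i <ᵇ j ∧ G i j)) ≡ sum (λ j → 𝟙 (G F.zero (F.suc j))) ℕ.+ ∑∑ (λ i j → 𝟙 (i <ᵇ j ∧ G (F.suc i) (F.suc j)))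
∑∑-<ᵇ-peelUpper {n} G = begin
  ∑∑ (λ i j → 𝟙 (i <ᵇ j ∧ G i j))
    ≡⟨ ∑∑-peelUpper (λ i j → 𝟙 (i <ᵇ j ∧ G i j)) (cong (λ b → 𝟙 (b ∧ G F.zero F.zero)) (<ᵇ-irrefl F.zero))
                      (λ i → cong (λ b → 𝟙 (b ∧ G (F.suc i) F.zero)) (suc<ᵇ0 i)) ⟩
  sum (λ j → 𝟙 (F.zero <ᵇ F.suc j ∧ G F.zero (F.suc j))) ℕ.+ ∑∑ (λ i j → 𝟙 (F.suc i <ᵇ F.suc j ∧ G (F.suc i) (F.suc j)))
    ≡⟨ cong₂ ℕ._+_ (sum-cong-≗ {n} (λ j → cong (λ b → 𝟙 (b ∧ G F.zero (F.suc j))) (0<ᵇsuc j)))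
                   (sum-cong-≗ {n} (λ i → sum-cong-≗ {n} (λ j → cong (λ b → 𝟙 (b ∧ G (F.suc i) (F.suc j))) (suc<ᵇsuc i j)))) ⟩
  sum (λ j → 𝟙 (G F.zero (F.suc j))) ℕ.+ ∑∑ (λ i j → 𝟙 (i <ᵇ j ∧ G (F.suc i) (F.suc j))) ∎
  where open ≡-Reasoning

module _ {A : Set} {P : Pred A 0ℓ} (P? : Decidable P) where

  length-filter-tabulate : ∀ {n} (f : Fin n → A) → length (filter P? (tabulate f)) ≡ sum (λ i → 𝟙 (does (P? (f i))))
  length-filter-tabulate {zero}  f = refl
  length-filter-tabulate {suc n} f with does (P? (f F.zero))
  ... | true  = cong suc (length-filter-tabulate (f ∘ F.suc))
  ... | false = length-filter-tabulate (f ∘ F.suc)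

  length-filter-map-filter-tabulate : ∀ {Q : Pred ℕ 0ℓ} (Q? : Decidable Q) (x : A → ℕ) {n} (f : Fin n → A) →
    length (filter Q? (map x (filter P? (tabulate f)))) ≡ sum (λ i → 𝟙 (does (P? (f i)) ∧ does (Q? (x (f i)))))
  length-filter-map-filter-tabulate Q? x {zero}  f = refl
  length-filter-map-filter-tabulate Q? x {suc n} f with does (P? (f F.zero))
  ... | false = length-filter-map-filter-tabulate Q? x (f ∘ F.suc)
  ... | true with does (Q? (x (f F.zero)))
  ...   | true  = cong suc (length-filter-map-filter-tabulate Q? x (f ∘ F.suc))
  ...   | false = length-filter-map-filter-tabulate Q? x (f ∘ F.suc)

  inv-map-filter-tabulate : ∀ (x : A → ℕ) {n} (f : Fin n → A) →
    inv (map x (filter P? (tabulate f))) ≡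
    ∑∑ (λ i j → 𝟙 (i <ᵇ j ∧ (does (P? (f i)) ∧ (does (P? (f j)) ∧ does (x (f j) <? x (f i))))))
  inv-map-filter-tabulate x {zero}  f = refl
  inv-map-filter-tabulate x {suc n} f = trans split (sym (∑∑-<ᵇ-peelUpper G))
    where
    G : Fin (suc n) → Fin (suc n) → Bool
    G i j = does (P? (f i)) ∧ (does (P? (f j)) ∧ does (x (f j) <? x (f i)))
    split : inv (map x (filter P? (tabulate f))) ≡
            sum (λ j → 𝟙 (G F.zero (F.suc j))) ℕ.+ ∑∑ (λ i j → 𝟙 (i <ᵇ j ∧ G (F.suc i) (F.suc j)))
    split with does (P? (f F.zero))
    ... | true  = cong₂ ℕ._+_ (length-filter-map-filter-tabulate (_<? x (f F.zero)) x (f ∘ F.suc))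
                              (inv-map-filter-tabulate x (f ∘ F.suc))
    ... | false = trans (inv-map-filter-tabulate x (f ∘ F.suc))
                        (cong (ℕ._+ ∑∑ (λ i j → 𝟙 (i <ᵇ j ∧ G (F.suc i) (F.suc j)))) (sym (sum-replicate-zero n)))

inversions : ∀ {m} → Word m → ℕ
inversions w = ∑∑ (λ i j → 𝟙 (i <ᵇ j ∧ does (w j <? w i)))

permWord : ∀ {m} → Perm m → Word m
permWord π i = toℕ (π ⟨$⟩ʳ i)

signWord≡neg1^inversions : ∀ {m} (w : Word m) → signWord w ≡ neg1^ (inversions w)
signWord≡neg1^inversions {m} w = cong neg1^ (begin
  inv (map w (allFin m))                               ≡⟨ cong (inv ∘ map w) (sym (LP.filter-all (λ _ → yes tt) (All.universal _ (allFin m)))) ⟩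
  inv (map w (filter (λ _ → yes tt) (allFin m)))       ≡⟨ inv-map-filter-tabulate (λ _ → yes tt) w (λ i → i) ⟩
  inversions w                                         ∎)
  where open ≡-Reasoning

signPerm≡neg1^inversions : ∀ {m} (π : Perm m) → signPerm π ≡ neg1^ (inversions (permWord π))
signPerm≡neg1^inversions π = signWord≡neg1^inversions (permWord π)

blockInversions : ∀ {m} → Word m → Word m → ℕ
blockInversions s x = ∑∑ (λ i j → 𝟙 (i <ᵇ j ∧ (does (s i ≟ s j) ∧ does (x j <? x i))))

-- The nonvanishing and the value of sgn_s(x)

prodℤ-map-neg1^ : ∀ {A : Set} (f : A → ℕ) (xs : List A) → prodℤ (map (neg1^ ∘ f) xs) ≡ neg1^ (∑ˡ (map f xs))
prodℤ-map-neg1^ f []       = refl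
prodℤ-map-neg1^ f (c ∷ xs) = trans (cong (neg1^ (f c) *_) (prodℤ-map-neg1^ f xs)) (sym (neg1^-+ (f c) _))

prodℤ≢0⇔ : ∀ (zs : List ℤ) → prodℤ zs ≢ + 0 ⇔ All (_≢ + 0) zs
prodℤ≢0⇔ zs = mk⇔ (to zs) (from zs)
  where
  to : ∀ zs → prodℤ zs ≢ + 0 → All (_≢ + 0) zs
  to []       _  = []
  to (z ∷ zs) nz = (λ z≡0 → nz (cong (_* prodℤ zs) z≡0))
                 ∷ to zs (λ p≡0 → nz (trans (cong (z *_) p≡0) (ℤP.*-zeroʳ z)))
  from : ∀ zs → All (_≢ + 0) zs → prodℤ zs ≢ + 0
  from []       _          ()
  from (z ∷ zs) (z≢0 ∷ nz) eq with ℤP.i*j≡0⇒i≡0∨j≡0 z eq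
  ... | inj₁ z≡0 = z≢0 z≡0
  ... | inj₂ p≡0 = from zs nz p≡0

isPermOf[k]⇔ : ∀ as → T (isPermOf[k] as) ⇔ (∀ v → 1 ≤ v → v ≤ length as → occ v as ≡ 1)
isPermOf[k]⇔ as = mk⇔
  (λ isPerm → λ { (suc v) _ v≤ → toWitness (AllP.applyUpTo⁻ _ (length as) (AllP.map⁻ (AllP.all⁺ _ _ isPerm)) v≤) })
  (λ occ≡1 → AllP.all⁻ _ (AllP.map⁺ (AllP.applyUpTo⁺₁ _ (length as) (λ {i} i< → fromWitness (occ≡1 (suc i) (s≤s z≤n) i<)))))

seqSgn≢0⇒isPermOf[k] : ∀ as → seqSgn as ≢ + 0 → T (isPermOf[k] as)
seqSgn≢0⇒isPermOf[k] as nz with isPermOf[k] as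
... | true  = tt
... | false = ⊥-elim (nz refl)

isPermOf[k]⇒seqSgn≡ : ∀ as → T (isPermOf[k] as) → seqSgn as ≡ neg1^ (inv as)
isPermOf[k]⇒seqSgn≡ as isPerm with isPermOf[k] as
... | true = refl

pairCount : ∀ {m} → Word m → Word m → ℕ → ℕ → ℕ
pairCount s x c v = sum (λ i → 𝟙 (does (s i ≟ c) ∧ does (x i ≟ v)))

UniquePairs : ∀ {m} → Word m → Word m → Set
UniquePairs s x = ∀ i v → 1 ≤ v → v ≤ count s (s i) → pairCount s x (s i) v ≡ 1

SgnNonzero : ∀ {m} → Word m → Word m → Set
SgnNonzero s x = sgnS s x ≢ + 0

count≡sum : ∀ {m} (s : Word m) c → count s c ≡ sum (λ i → 𝟙 (does (s i ≟ c)))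
count≡sum s c = length-filter-tabulate (λ j → s j ≟ c) (λ i → i)

block : ∀ {m} → Word m → Word m → ℕ → List ℕ
block s x c = map x (positions s c)

length-block : ∀ {m} (s x : Word m) c → length (block s x c) ≡ count s c
length-block s x c = LP.length-map x (positions s c)

occ-block : ∀ {m} (s x : Word m) c v → occ v (block s x c) ≡ pairCount s x c v
occ-block s x c v = length-filter-map-filter-tabulate (λ j → s j ≟ c) (_≟ v) x (λ i → i)

∈-letters⁻ : ∀ {m} (s : Word m) {c} → c ∈ letters s → ∃ λ i → s i ≡ c
∈-letters⁻ s c∈ with MP.∈-map⁻ s (MP.∈-deduplicate⁻ _≟_ (wordList s) c∈)
... | i , _ , c≡sᵢ = i , sym c≡sᵢ

∈-letters⁺ : ∀ {m} (s : Word m) i → s i ∈ letters s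
∈-letters⁺ s i = MP.∈-deduplicate⁺ _≟_ (MP.∈-map⁺ s (MP.∈-allFin i))

SgnNonzero⇒blocksArePerms : ∀ {m} (s x : Word m) → SgnNonzero s x → All (λ c → T (isPermOf[k] (block s x c))) (letters s)
SgnNonzero⇒blocksArePerms s x nz =
  All.map (λ {c} → seqSgn≢0⇒isPermOf[k] (block s x c)) (AllP.map⁻ (Equivalence.to (prodℤ≢0⇔ _) nz))

SgnNonzero⇔UniquePairs : ∀ {m} (s x : Word m) → SgnNonzero s x ⇔ UniquePairs s x
SgnNonzero⇔UniquePairs s x = mk⇔ to from
  where
  to : SgnNonzero s x → UniquePairs s x
  to nz i v 1≤v v≤ = trans (sym (occ-block s x (s i) v))
    (Equivalence.to (isPermOf[k]⇔ (block s x (s i))) (All.lookup (SgnNonzero⇒blocksArePerms s x nz) (∈-letters⁺ s i))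
      v 1≤v (subst (v ≤_) (sym (length-block s x (s i))) v≤))
  blockIsPerm : UniquePairs s x → ∀ c → (∃ λ i → s i ≡ c) → seqSgn (block s x c) ≢ + 0
  blockIsPerm unique .(s i) (i , refl) = neg1^≢0 (inv B) ∘ trans (sym (isPermOf[k]⇒seqSgn≡ B isPerm))
    where
    B : List ℕ
    B = block s x (s i)
    isPerm : T (isPermOf[k] B)
    isPerm = Equivalence.from (isPermOf[k]⇔ B)
      (λ v 1≤v v≤ → trans (occ-block s x (s i) v) (unique i v 1≤v (subst (v ≤_) (length-block s x (s i)) v≤)))
  from : UniquePairs s x → SgnNonzero s x
  from unique = Equivalence.from (prodℤ≢0⇔ _) (AllP.map⁺ (All.tabulate (λ {c} c∈ → blockIsPerm unique c (∈-letters⁻ s c∈))))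

∑ˡ-map-sum : ∀ {A : Set} {n} (f : A → Fin n → ℕ) (xs : List A) →
  ∑ˡ (map (λ c → sum (f c)) xs) ≡ sum (λ i → ∑ˡ (map (λ c → f c i) xs))
∑ˡ-map-sum {n = n} f []       = sym (sum-replicate-zero n)
∑ˡ-map-sum         f (c ∷ xs) = trans (cong (sum (f c) ℕ.+_) (∑ˡ-map-sum f xs)) (sym (∑-distrib-+ (f c) _))

∑ˡ-map-∑∑ : ∀ {A : Set} {n} (F : A → Fin n → Fin n → ℕ) (xs : List A) →
  ∑ˡ (map (λ c → ∑∑ (F c)) xs) ≡ ∑∑ (λ i j → ∑ˡ (map (λ c → F c i j) xs))
∑ˡ-map-∑∑ {n = n} F xs = trans (∑ˡ-map-sum (λ c i → sum (F c i)) xs) (sum-cong-≗ {n} (λ i → ∑ˡ-map-sum (λ c → F c i) xs))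

∑ˡ-select : ∀ (cs : List ℕ) a (Y : ℕ → Bool) → Unique cs → a ∈ cs → ∑ˡ (map (λ c → 𝟙 (does (a ≟ c) ∧ Y c)) cs) ≡ 𝟙 (Y a)
∑ˡ-select (c ∷ cs) a Y (a≢cs ∷ _) (here refl) =
  trans (cong₂ ℕ._+_ (cong (λ b → 𝟙 (b ∧ Y a)) (dec-true (a ≟ a) refl)) (absent cs a≢cs)) (ℕP.+-identityʳ _)
  where
  absent : ∀ cs → All (a ≢_) cs → ∑ˡ (map (λ c → 𝟙 (does (a ≟ c) ∧ Y c)) cs) ≡ 0
  absent []       []             = refl
  absent (c ∷ cs) (a≢c ∷ a≢cs) = cong₂ ℕ._+_ (cong (λ b → 𝟙 (b ∧ Y c)) (dec-false (a ≟ c) a≢c)) (absent cs a≢cs)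
∑ˡ-select (c ∷ cs) a Y (c≢cs ∷ unique) (there a∈cs) =
  cong₂ ℕ._+_ (cong (λ b → 𝟙 (b ∧ Y c)) (dec-false (a ≟ c) (λ a≡c → All.lookup c≢cs a∈cs (sym a≡c))))
              (∑ˡ-select cs a Y unique a∈cs)

does-≟-sym : ∀ (a b : ℕ) → does (a ≟ b) ≡ does (b ≟ a)
does-≟-sym a b = same (a ≟ b) (b ≟ a)
  where
  same : (d : Dec (a ≡ b)) (d′ : Dec (b ≡ a)) → does d ≡ does d′
  same (yes _)   (yes _)   = refl
  same (no _)    (no _)    = refl
  same (yes a≡b) (no b≢a)  = ⊥-elim (b≢a (sym a≡b))
  same (no a≢b)  (yes b≡a) = ⊥-elim (a≢b (sym b≡a))

sgnS≡neg1^blockInversions : ∀ {m} (s x : Word m) → SgnNonzero s x → sgnS s x ≡ neg1^ (blockInversions s x)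
sgnS≡neg1^blockInversions {m} s x nz = begin
  sgnS s x
    ≡⟨ cong prodℤ (LP.map-cong-local (All.map (λ {c} → isPermOf[k]⇒seqSgn≡ (block s x c)) (SgnNonzero⇒blocksArePerms s x nz))) ⟩
  prodℤ (map (λ c → neg1^ (inv (block s x c))) (letters s))
    ≡⟨ prodℤ-map-neg1^ (λ c → inv (block s x c)) (letters s) ⟩
  neg1^ (∑ˡ (map (λ c → inv (block s x c)) (letters s)))
    ≡⟨ cong neg1^ (trans (cong ∑ˡ (LP.map-cong (λ c → inv-map-filter-tabulate (λ j → s j ≟ c) x (λ i → i)) (letters s)))
                         (∑ˡ-map-∑∑ H (letters s))) ⟩
  neg1^ (∑∑ (λ i j → ∑ˡ (map (λ c → H c i j) (letters s))))
    ≡⟨ cong neg1^ (sum-cong-≗ {m} (λ i → sum-cong-≗ {m} (λ j → selectLetter i j))) ⟩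
  neg1^ (blockInversions s x) ∎
  where
  open ≡-Reasoning
  H : ℕ → Fin m → Fin m → ℕ
  H c i j = 𝟙 (i <ᵇ j ∧ (does (s i ≟ c) ∧ (does (s j ≟ c) ∧ does (x j <? x i))))
  selectLetter : ∀ i j → ∑ˡ (map (λ c → H c i j) (letters s)) ≡ 𝟙 (i <ᵇ j ∧ (does (s i ≟ s j) ∧ does (x j <? x i)))
  selectLetter i j = begin
    ∑ˡ (map (λ c → H c i j) (letters s))
      ≡⟨ cong ∑ˡ (LP.map-cong (λ c → cong 𝟙 (∧-swap (i <ᵇ j) (does (s i ≟ c)) _)) (letters s)) ⟩
    ∑ˡ (map (λ c → 𝟙 (does (s i ≟ c) ∧ (i <ᵇ j ∧ (does (s j ≟ c) ∧ does (x j <? x i))))) (letters s))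
      ≡⟨ ∑ˡ-select (letters s) (s i) (λ c → i <ᵇ j ∧ (does (s j ≟ c) ∧ does (x j <? x i)))
                   (UP.deduplicate-! _≟_ (wordList s)) (∈-letters⁺ s i) ⟩
    𝟙 (i <ᵇ j ∧ (does (s j ≟ s i) ∧ does (x j <? x i)))
      ≡⟨ cong (λ b → 𝟙 (i <ᵇ j ∧ (b ∧ does (x j <? x i)))) (does-≟-sym (s j) (s i)) ⟩
    𝟙 (i <ᵇ j ∧ (does (s i ≟ s j) ∧ does (x j <? x i))) ∎
    where
    ∧-swap : ∀ a b c → a ∧ (b ∧ c) ≡ b ∧ (a ∧ c)
    ∧-swap a b c = trans (sym (∧-assoc a b c)) (trans (cong (_∧ c) (∧-comm a b)) (∧-assoc b a c))

outside : ∀ {m} → Word m → Word m → ℕ → ℕ → ℕ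
outside s x c k = sum (λ i → 𝟙 (does (s i ≟ c) ∧ not (does (1 ≤? x i) ∧ does (x i <? 1 ℕ.+ k))))

count≡pairCounts+outside : ∀ {m} (s x : Word m) c k →
  count s c ≡ sum {k} (λ j → pairCount s x c (suc (toℕ j))) ℕ.+ outside s x c k
count≡pairCounts+outside {m} s x c k = begin
  count s c
    ≡⟨ count≡sum s c ⟩
  sum (λ i → 𝟙 (does (s i ≟ c)))
    ≡⟨ sum-cong-≗ {m} (λ i → split (does (s i ≟ c)) (inside (x i))) ⟩
  sum (λ i → 𝟙 (does (s i ≟ c) ∧ inside (x i)) ℕ.+ 𝟙 (does (s i ≟ c) ∧ not (inside (x i))))
    ≡⟨ ∑-distrib-+ (λ i → 𝟙 (does (s i ≟ c) ∧ inside (x i))) _ ⟩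
  sum (λ i → 𝟙 (does (s i ≟ c) ∧ inside (x i))) ℕ.+ outside s x c k
    ≡⟨ cong (ℕ._+ outside s x c k) (trans (sum-cong-≗ {m} (λ i → byValue (does (s i ≟ c)) (x i)))
                                          (∑-comm {m} {k} (λ i j → 𝟙 (does (s i ≟ c) ∧ does (x i ≟ suc (toℕ j)))))) ⟩
  sum {k} (λ j → pairCount s x c (suc (toℕ j))) ℕ.+ outside s x c k ∎
  where
  open ≡-Reasoning
  inside : ℕ → Bool
  inside y = does (1 ≤? y) ∧ does (y <? 1 ℕ.+ k)
  split : ∀ b r → 𝟙 b ≡ 𝟙 (b ∧ r) ℕ.+ 𝟙 (b ∧ not r)
  split true  true  = refl
  split true  false = refl
  split false _     = refl
  byValue : ∀ b y → 𝟙 (b ∧ inside y) ≡ sum {k} (λ j → 𝟙 (b ∧ does (y ≟ suc (toℕ j))))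
  byValue true  y = sym (sum-𝟙-≟-shift k 1 y)
  byValue false y = sym (sum-replicate-zero k)

count-pos⇒∃ : ∀ {m} (s : Word m) c → 1 ≤ count s c → ∃ λ i → s i ≡ c
count-pos⇒∃ s c pos with sum-pos⇒term-pos (λ j → 𝟙 (does (s j ≟ c))) (subst (1 ≤_) (count≡sum s c) pos)
... | i , sᵢ≡c = i , 𝟙-does⇒ (s i ≟ c) sᵢ≡c

pairIndicator-pos : ∀ {c v a b} → a ≡ c → b ≡ v → 1 ≤ 𝟙 (does (a ≟ c) ∧ does (b ≟ v))
pairIndicator-pos {c} {v} {a} {b} a≡c b≡v =
  subst (λ z → 1 ≤ 𝟙 z) (sym (cong₂ _∧_ (dec-true (a ≟ c) a≡c) (dec-true (b ≟ v) b≡v))) (s≤s z≤n)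

pairCount-pos : ∀ {m} (s x : Word m) i {c v} → s i ≡ c → x i ≡ v → 1 ≤ pairCount s x c v
pairCount-pos s x i {c} {v} sᵢ≡c xᵢ≡v =
  term-pos⇒sum-pos (λ j → 𝟙 (does (s j ≟ c) ∧ does (x j ≟ v))) i (pairIndicator-pos sᵢ≡c xᵢ≡v)

pairCount-pos⇒∃ : ∀ {m} (s x : Word m) c v → 1 ≤ pairCount s x c v → ∃ λ i → s i ≡ c × x i ≡ v
pairCount-pos⇒∃ s x c v pos with sum-pos⇒term-pos (λ j → 𝟙 (does (s j ≟ c) ∧ does (x j ≟ v))) pos
... | i , both = i , bothHold (s i ≟ c) (x i ≟ v) both
  where
  bothHold : ∀ {P Q : Set} (p? : Dec P) (q? : Dec Q) → 1 ≤ 𝟙 (does p? ∧ does q?) → P × Q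
  bothHold (yes p) (yes q) _ = p , q

UniquePairs⇒inRange : ∀ {m} (s x : Word m) → UniquePairs s x → ∀ i → 1 ≤ x i × x i ≤ count s (s i)
UniquePairs⇒inRange s x unique i =
  does-true⇒ (1 ≤? x i) (Equivalence.to T-≡ (proj₁ bounds)) ,
  ℕP.≤-pred (does-true⇒ (x i <? 1 ℕ.+ k) (Equivalence.to T-≡ (proj₂ bounds)))
  where
  k : ℕ
  k = count s (s i)
  r : ℕ → Bool
  r y = does (1 ≤? y) ∧ does (y <? 1 ℕ.+ k)
  outside≡0 : outside s x (s i) k ≡ 0
  outside≡0 = ℕP.+-cancelˡ-≡ k _ 0 (trans (sym (trans (count≡pairCounts+outside s x (s i) k)
    (cong (ℕ._+ outside s x (s i) k) (trans (sum-cong-≗ {k} (λ j → unique i (suc (toℕ j)) (s≤s z≤n) (FP.toℕ<n j))) (sum-ones k)))))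
    (sym (ℕP.+-identityʳ k)))
  notOutside : ∀ b → 𝟙 (not b) ≡ 0 → T b
  notOutside true _ = tt
  inside : T (r (x i))
  inside = notOutside (r (x i)) (trans (cong (λ a → 𝟙 (a ∧ not (r (x i)))) (sym (dec-true (s i ≟ s i) refl)))
                                       (sum≡0⇒term≡0 (λ j → 𝟙 (does (s j ≟ s i) ∧ not (r (x j)))) outside≡0 i))
  bounds : T (does (1 ≤? x i)) × T (does (x i <? 1 ℕ.+ k))
  bounds = Equivalence.to T-∧ inside

PairsDistinct : ∀ {m} → Word m → Word m → Set
PairsDistinct s x = ∀ k l → s k ≡ s l → x k ≡ x l → k ≡ l

PairsDistinct-swap : ∀ {m} {s x : Word m} → PairsDistinct s x → PairsDistinct x s
PairsDistinct-swap distinct k l xₖ≡xₗ sₖ≡sₗ = distinct k l sₖ≡sₗ xₖ≡xₗ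

UniquePairs⇒PairsDistinct : ∀ {m} (s x : Word m) → UniquePairs s x → PairsDistinct s x
UniquePairs⇒PairsDistinct s x unique i j sᵢ≡sⱼ xᵢ≡xⱼ with i FP.≟ j
... | yes i≡j = i≡j
... | no i≢j  = ⊥-elim (ℕP.<-irrefl refl (subst (2 ≤_) (unique i (x i) 1≤xᵢ xᵢ≤) twice))
  where
  1≤xᵢ : 1 ≤ x i
  1≤xᵢ = proj₁ (UniquePairs⇒inRange s x unique i)
  xᵢ≤ : x i ≤ count s (s i)
  xᵢ≤ = proj₂ (UniquePairs⇒inRange s x unique i)
  twice : 2 ≤ pairCount s x (s i) (x i)
  twice = two-terms-pos⇒sum≥2 (λ k → 𝟙 (does (s k ≟ s i) ∧ does (x k ≟ x i))) i j i≢j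
    (pairIndicator-pos {s i} {x i} refl refl) (pairIndicator-pos (sym sᵢ≡sⱼ) (sym xᵢ≡xⱼ))

SgnNonzero⇒PairsDistinct : ∀ {m} (s x : Word m) → SgnNonzero s x → PairsDistinct s x
SgnNonzero⇒PairsDistinct s x = UniquePairs⇒PairsDistinct s x ∘ Equivalence.to (SgnNonzero⇔UniquePairs s x)

-- The count bound forces each required pair to occur exactly once.
allPairsOccur⇒UniquePairs : ∀ {m} (s x : Word m) →
  (∀ i v → 1 ≤ v → v ≤ count s (s i) → ∃ λ j → s j ≡ s i × x j ≡ v) → UniquePairs s x
allPairsOccur⇒UniquePairs s x occurs i (suc v) (s≤s z≤n) v<k =
  trans (cong (pairCount s x (s i) ∘ suc) (sym (FP.toℕ-fromℕ< v<k)))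
        (terms-pos∧sum≤n⇒terms≡1 f pos sum≤k (F.fromℕ< v<k))
  where
  k : ℕ
  k = count s (s i)
  f : Fin k → ℕ
  f j = pairCount s x (s i) (suc (toℕ j))
  pos : ∀ j → 1 ≤ f j
  pos j with occurs i (suc (toℕ j)) (s≤s z≤n) (FP.toℕ<n j)
  ... | l , sₗ≡sᵢ , xₗ≡ = pairCount-pos s x l sₗ≡sᵢ xₗ≡
  sum≤k : sum f ≤ k
  sum≤k = subst (sum f ≤_) (sym (count≡pairCounts+outside s x (s i) k)) (ℕP.m≤m+n (sum f) _)

-- The action of S_m on words

sum-permute⁻¹ : ∀ {m} (π : Perm m) (f : Fin m → ℕ) → sum f ≡ sum (λ j → f (π ⟨$⟩ˡ j))
sum-permute⁻¹ π f = ∑-permute f (flip π)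

∑∑-permute : ∀ {m} (π : Perm m) (F : Fin m → Fin m → ℕ) → ∑∑ F ≡ ∑∑ (λ a b → F (π ⟨$⟩ʳ a) (π ⟨$⟩ʳ b))
∑∑-permute {m} π F = trans (∑-permute (λ k → sum (F k)) π) (sum-cong-≗ {m} (λ a → ∑-permute (F (π ⟨$⟩ʳ a)) π))

act-inverseˡ : ∀ {m} (π : Perm m) (w : Word m) → act (π ⁻¹) (act π w) ≗ w
act-inverseˡ π w i = cong w (inverseˡ π)

act-cong : ∀ {m} {σ τ : Perm m} (w : Word m) → σ ≈ₚ τ → act σ w ≗ act τ w
act-cong {σ = σ} {τ} w σ≈τ i = cong w (trans (sym (inverseˡ τ)) (cong (τ ⟨$⟩ˡ_) (trans (sym (σ≈τ (σ ⟨$⟩ˡ i))) (inverseʳ σ))))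

count-act : ∀ {m} (π : Perm m) (w : Word m) c → count (act π w) c ≡ count w c
count-act π w c = trans (count≡sum (act π w) c) (trans (sym (sum-permute⁻¹ π (λ i → 𝟙 (does (w i ≟ c))))) (sym (count≡sum w c)))

count-cong : ∀ {m} {s s′ : Word m} → s ≗ s′ → ∀ c → count s c ≡ count s′ c
count-cong {m} {s} {s′} s≗s′ c =
  trans (count≡sum s c) (trans (sum-cong-≗ {m} (λ i → cong (λ z → 𝟙 (does (z ≟ c))) (s≗s′ i))) (sym (count≡sum s′ c)))

InA-act : ∀ {m α} (π : Perm m) (w : Word m) → InA α w → InA α (act π w)
InA-act π w w∈A c = trans (count-act π w c) (w∈A c)

pairCount-act : ∀ {m} (π : Perm m) (s x : Word m) c v → pairCount (act π s) (act π x) c v ≡ pairCount s x c v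
pairCount-act π s x c v = sym (sum-permute⁻¹ π (λ i → 𝟙 (does (s i ≟ c) ∧ does (x i ≟ v))))

pairCount-cong : ∀ {m} {s s′ x x′ : Word m} → s ≗ s′ → x ≗ x′ → ∀ c v → pairCount s x c v ≡ pairCount s′ x′ c v
pairCount-cong {m} s≗s′ x≗x′ c v = sum-cong-≗ {m} (λ i → cong₂ (λ a b → 𝟙 (does (a ≟ c) ∧ does (b ≟ v))) (s≗s′ i) (x≗x′ i))

UniquePairs-act : ∀ {m} (π : Perm m) (s x : Word m) → UniquePairs s x → UniquePairs (act π s) (act π x)
UniquePairs-act π s x unique j v 1≤v v≤ =
  trans (pairCount-act π s x _ v) (unique (π ⟨$⟩ˡ j) v 1≤v (subst (v ≤_) (count-act π s _) v≤))

UniquePairs-cong : ∀ {m} {s s′ x x′ : Word m} → s ≗ s′ → x ≗ x′ → UniquePairs s x → UniquePairs s′ x′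
UniquePairs-cong {s = s} {s′} {x} {x′} s≗s′ x≗x′ unique i v 1≤v v≤ =
  trans (sym (trans (pairCount-cong s≗s′ x≗x′ (s i) v) (cong (λ c → pairCount s′ x′ c v) (s≗s′ i))))
        (unique i v 1≤v (subst (v ≤_) (sym (trans (count-cong s≗s′ (s i)) (cong (count s′) (s≗s′ i)))) v≤))

SgnNonzero-act : ∀ {m} (π : Perm m) (s x : Word m) → SgnNonzero s x → SgnNonzero (act π s) (act π x)
SgnNonzero-act π s x nz = Equivalence.from (SgnNonzero⇔UniquePairs _ _)
  (UniquePairs-act π s x (Equivalence.to (SgnNonzero⇔UniquePairs s x) nz))

sgnS-cong : ∀ {m} (s : Word m) {x x′ : Word m} → x ≗ x′ → sgnS s x ≡ sgnS s x′
sgnS-cong s x≗x′ = cong prodℤ (LP.map-cong (λ c → cong seqSgn (LP.map-cong x≗x′ (positions s c))) (letters s))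

SgnNonzero-cong : ∀ {m} {s s′ x x′ : Word m} → s ≗ s′ → x ≗ x′ → SgnNonzero s x → SgnNonzero s′ x′
SgnNonzero-cong s≗s′ x≗x′ nz = Equivalence.from (SgnNonzero⇔UniquePairs _ _)
  (UniquePairs-cong s≗s′ x≗x′ (Equivalence.to (SgnNonzero⇔UniquePairs _ _) nz))

-- Signs as parities of lexicographic tournaments

lexGreater : ∀ {m} → Word m → Word m → Fin m → Fin m → Bool
lexGreater a b k l = does (a l <? a k) ∨ (does (a k ≟ a l) ∧ does (b l <? b k))

forwardArcs-lexGreater : ∀ {m} (a b : Word m) → forwardArcs (lexGreater a b) ≡ inversions a ℕ.+ blockInversions a b
forwardArcs-lexGreater {m} a b = trans
  (sum-cong-≗ {m} (λ k → sum-cong-≗ {m} (λ l → disjoint (k <ᵇ l) (does (a l <? a k)) (does (a k ≟ a l)) (does (b l <? b k))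
    (λ aₗ<aₖ → dec-false (a k ≟ a l) (λ aₖ≡aₗ → ℕP.<-irrefl (sym aₖ≡aₗ) (does-true⇒ (a l <? a k) aₗ<aₖ))))))
  (∑∑-+ (λ k l → 𝟙 (k <ᵇ l ∧ does (a l <? a k))) (λ k l → 𝟙 (k <ᵇ l ∧ (does (a k ≟ a l) ∧ does (b l <? b k)))))
  where
  disjoint : ∀ o p e q → (p ≡ true → e ≡ false) → 𝟙 (o ∧ (p ∨ (e ∧ q))) ≡ 𝟙 (o ∧ p) ℕ.+ 𝟙 (o ∧ (e ∧ q))
  disjoint false p    e q _ = refl
  disjoint true  true e q p⇒¬e rewrite p⇒¬e refl = refl
  disjoint true  false e q _ = refl

lexGreater-tournament : ∀ {m} (a b : Word m) → PairsDistinct a b → IsTournament (lexGreater a b)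
lexGreater-tournament a b distinct = flipped
  where
  lexFlip : ∀ x₁ x₂ y₁ y₂ → ¬ (x₁ ≡ x₂ × y₁ ≡ y₂) →
    does (x₁ <? x₂) ∨ (does (x₂ ≟ x₁) ∧ does (y₁ <? y₂)) ≡ not (does (x₂ <? x₁) ∨ (does (x₁ ≟ x₂) ∧ does (y₂ <? y₁)))
  lexFlip x₁ x₂ y₁ y₂ ne with ℕP.<-cmp x₁ x₂
  ... | tri< p _ _ rewrite dec-true (x₁ <? x₂) p | dec-false (x₂ <? x₁) (ℕP.<-asym p) | dec-false (x₁ ≟ x₂) (λ e → ℕP.<-irrefl e p) = refl
  ... | tri> _ _ q rewrite dec-false (x₁ <? x₂) (ℕP.<-asym q) | dec-true (x₂ <? x₁) q | dec-false (x₂ ≟ x₁) (λ e → ℕP.<-irrefl e q) = refl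
  ... | tri≈ _ refl _ with ℕP.<-cmp y₁ y₂
  ...   | tri< p _ _ rewrite dec-false (x₁ <? x₁) (ℕP.<-irrefl refl) | dec-true (x₁ ≟ x₁) refl
                           | dec-true (y₁ <? y₂) p | dec-false (y₂ <? y₁) (ℕP.<-asym p) = refl
  ...   | tri≈ _ e _ = ⊥-elim (ne (refl , e))
  ...   | tri> _ _ q rewrite dec-false (x₁ <? x₁) (ℕP.<-irrefl refl) | dec-true (x₁ ≟ x₁) refl
                           | dec-false (y₁ <? y₂) (ℕP.<-asym q) | dec-true (y₂ <? y₁) q = refl
  flipped : ∀ k l → k ≢ l → lexGreater a b l k ≡ not (lexGreater a b k l)
  flipped k l k≢l = lexFlip (a k) (a l) (b k) (b l) (λ (aₖ≡aₗ , bₖ≡bₗ) → k≢l (distinct k l aₖ≡aₗ bₖ≡bₗ))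

forwardArcs-cong : ∀ {m} {g g′ : Fin m → Fin m → Bool} → (∀ k l → g k l ≡ g′ k l) → forwardArcs g ≡ forwardArcs g′
forwardArcs-cong {m} g≡g′ = sum-cong-≗ {m} (λ k → sum-cong-≗ {m} (λ l → cong (λ b → 𝟙 (k <ᵇ l ∧ b)) (g≡g′ k l)))

lexGreater-cong : ∀ {m} {a a′ b b′ : Word m} → a ≗ a′ → b ≗ b′ → ∀ k l → lexGreater a b k l ≡ lexGreater a′ b′ k l
lexGreater-cong a≗a′ b≗b′ k l = cong₂ _∨_ (cong₂ (λ p q → does (p <? q)) (a≗a′ l) (a≗a′ k))
  (cong₂ _∧_ (cong₂ (λ p q → does (p ≟ q)) (a≗a′ k) (a≗a′ l)) (cong₂ (λ p q → does (p <? q)) (b≗b′ l) (b≗b′ k)))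

forwardArcs-relabel : ∀ {m} (π : Perm m) (g : Fin m → Fin m → Bool) →
  forwardArcs (λ k l → g (π ⟨$⟩ˡ k) (π ⟨$⟩ˡ l)) ≡ ascendingArcs π g
forwardArcs-relabel {m} π g = trans (∑∑-permute π (λ k l → 𝟙 (k <ᵇ l ∧ g (π ⟨$⟩ˡ k) (π ⟨$⟩ˡ l))))
  (sum-cong-≗ {m} (λ a → sum-cong-≗ {m} (λ b →
    cong₂ (λ z w → 𝟙 ((π ⟨$⟩ʳ a) <ᵇ (π ⟨$⟩ʳ b) ∧ g z w)) (inverseˡ π) (inverseˡ π))))

forwardArcs-lexGreater-act : ∀ {m} (π : Perm m) (a b : Word m) →
  forwardArcs (lexGreater (act π a) (act π b)) ≡ ascendingArcs π (lexGreater a b)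
forwardArcs-lexGreater-act π a b = forwardArcs-relabel π (lexGreater a b)

inversions-cong : ∀ {m} {a a′ : Word m} → a ≗ a′ → inversions a ≡ inversions a′
inversions-cong {m} a≗a′ = sum-cong-≗ {m} (λ i → sum-cong-≗ {m} (λ j →
  cong₂ (λ z w → 𝟙 (i <ᵇ j ∧ does (z <? w))) (a≗a′ j) (a≗a′ i)))

blockInversions-cong : ∀ {m} {a a′ x x′ : Word m} → a ≗ a′ → x ≗ x′ → blockInversions a x ≡ blockInversions a′ x′
blockInversions-cong {m} a≗a′ x≗x′ = sum-cong-≗ {m} (λ i → sum-cong-≗ {m} (λ j →
  cong₂ (λ z w → 𝟙 (i <ᵇ j ∧ (z ∧ w))) (cong₂ (λ p q → does (p ≟ q)) (a≗a′ i) (a≗a′ j))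
                                       (cong₂ (λ p q → does (p <? q)) (x≗x′ j) (x≗x′ i))))

ascendingArcs-reverse : ∀ {m} (π : Perm m) → ascendingArcs π (λ k l → l <ᵇ k) ≡ inversions (permWord π)
ascendingArcs-reverse {m} π = trans (∑-comm (λ k l → 𝟙 ((π ⟨$⟩ʳ k) <ᵇ (π ⟨$⟩ʳ l) ∧ l <ᵇ k)))
  (sum-cong-≗ {m} (λ a → sum-cong-≗ {m} (λ b →
    trans (cong 𝟙 (∧-comm ((π ⟨$⟩ʳ b) <ᵇ (π ⟨$⟩ʳ a)) (a <ᵇ b)))
          (cong (λ z → 𝟙 (a <ᵇ b ∧ z)) (<ᵇ-unfold (π ⟨$⟩ʳ b) (π ⟨$⟩ʳ a))))))

ascendingArcs⁻¹-reverse : ∀ {m} (π : Perm m) → ascendingArcs (π ⁻¹) (λ k l → l <ᵇ k) ≡ inversions (permWord π)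
ascendingArcs⁻¹-reverse {m} π = sym (trans (∑∑-permute (π ⁻¹) _) (sum-cong-≗ {m} (λ a → sum-cong-≗ {m} (λ b →
  cong (λ z → 𝟙 ((π ⟨$⟩ˡ a) <ᵇ (π ⟨$⟩ˡ b) ∧ z))
    (trans (cong₂ (λ p q → does (toℕ p <? toℕ q)) (inverseʳ π) (inverseʳ π)) (sym (<ᵇ-unfold b a)))))))

-- Relabelled by x, the tournament lexGreater s v counts the inversions of (s, x v); ascendingArcs-≡₂ compares
-- that count with those of (s, v) and of x.
sgnS-act-stabiliser : ∀ {m} (s v : Word m) (x : Perm m) → InY s x → SgnNonzero s v →
  sgnS s (act x v) ≡ signPerm x * sgnS s v
sgnS-act-stabiliser s v x x∈Yₛ nz = begin
  sgnS s (act x v)                       ≡⟨ sgnS≡neg1^blockInversions s (act x v) nz′ ⟩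
  neg1^ (blockInversions s (act x v))    ≡⟨ neg1^-split (blockInversions s (act x v)) (inversions (permWord x)) _ exponents ⟩
  neg1^ (inversions (permWord x)) * neg1^ (blockInversions s v)
                                         ≡⟨ sym (cong₂ _*_ (signPerm≡neg1^inversions x) (sgnS≡neg1^blockInversions s v nz)) ⟩
  signPerm x * sgnS s v                  ∎
  where
  open ≡-Reasoning
  nz′ : SgnNonzero s (act x v)
  nz′ = SgnNonzero-cong x∈Yₛ (λ _ → refl) (SgnNonzero-act x s v nz)
  ascending≡ : ascendingArcs x (lexGreater s v) ≡ inversions s ℕ.+ blockInversions s (act x v)
  ascending≡ = trans (sym (forwardArcs-lexGreater-act x s v))
    (trans (forwardArcs-lexGreater (act x s) (act x v))
           (cong₂ ℕ._+_ (inversions-cong x∈Yₛ) (blockInversions-cong {x = act x v} x∈Yₛ (λ _ → refl))))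
  exponents : blockInversions s (act x v) ℕ.+ inversions (permWord x) ≡₂ blockInversions s v
  exponents = +-cancelˡ-≡₂ (inversions s) (≡₂-trans
    (≡₂-reflexive (trans (sym (ℕP.+-assoc (inversions s) _ _)) (sym (cong₂ ℕ._+_ ascending≡ (ascendingArcs-reverse x)))))
    (≡₂-trans (ascendingArcs-≡₂ x (lexGreater s v) (lexGreater-tournament s v
                (SgnNonzero⇒PairsDistinct s v nz)))
              (≡₂-reflexive (forwardArcs-lexGreater s v))))

-- For π ∈ G(s,t), f(s,t) = (-1)^Φ(s, πt).
Φ : ∀ {m} → Word m → Word m → ℕ
Φ s u = forwardArcs (lexGreater s u) ℕ.+ forwardArcs (lexGreater u s)

Φ-act-≡₂ : ∀ {m} (s₀ u₀ s u : Word m) (h : Perm m) → PairsDistinct s₀ u₀ → s ≗ act h s₀ → u ≗ act h u₀ →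
  Φ s u ≡₂ Φ s₀ u₀
Φ-act-≡₂ s₀ u₀ s u h distinct s≗ u≗ =
  ≡₂-trans (≡₂-reflexive relabelled)
  (≡₂-trans (≡₂-sym (≡₂-trans (+-cong-≡₂ ≡₂-refl (n+n≡₂0 rev)) (≡₂-reflexive (ℕP.+-identityʳ _))))
  (≡₂-trans (≡₂-reflexive (regroup (ascendingArcs h (lexGreater s₀ u₀)) (ascendingArcs h (lexGreater u₀ s₀)) rev))
            (+-cong-≡₂ (ascendingArcs-≡₂ h (lexGreater s₀ u₀) (lexGreater-tournament s₀ u₀ distinct))
                       (ascendingArcs-≡₂ h (lexGreater u₀ s₀) (lexGreater-tournament u₀ s₀ (PairsDistinct-swap distinct))))))
  where
  rev : ℕ
  rev = ascendingArcs h (λ k l → l <ᵇ k)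
  relabelled : Φ s u ≡ ascendingArcs h (lexGreater s₀ u₀) ℕ.+ ascendingArcs h (lexGreater u₀ s₀)
  relabelled = cong₂ ℕ._+_
    (trans (forwardArcs-cong (lexGreater-cong s≗ u≗)) (forwardArcs-lexGreater-act h s₀ u₀))
    (trans (forwardArcs-cong (lexGreater-cong u≗ s≗)) (forwardArcs-lexGreater-act h u₀ s₀))
  regroup : ∀ a b c → (a ℕ.+ b) ℕ.+ (c ℕ.+ c) ≡ (a ℕ.+ c) ℕ.+ (b ℕ.+ c)
  regroup = solve 3 (λ a b c → (a :+ b) :+ (c :+ c) := (a :+ c) :+ (b :+ c)) refl
    where open +-*-Solver

f≡neg1^Φ : ∀ {m} (s t : Word m) (π : Perm m) → SgnNonzero s (act π t) → SgnNonzero t (act (π ⁻¹) s) →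
  signWord s * signG s t π * signWord t ≡ neg1^ (Φ s (act π t))
f≡neg1^Φ {m} s t π nz nz⁻¹ = begin
  signWord s * (sgnS s u * signPerm π * sgnS t (act ρ s)) * signWord t
    ≡⟨ cong₂ _*_ (cong₂ _*_ (signWord≡neg1^inversions s)
                            (cong₂ _*_ (cong₂ _*_ (sgnS≡neg1^blockInversions s u nz) (signPerm≡neg1^inversions π))
                                       (sgnS≡neg1^blockInversions t (act ρ s) nz⁻¹)))
                 (signWord≡neg1^inversions t) ⟩
  neg1^ a * (neg1^ b * neg1^ c * neg1^ d) * neg1^ e
    ≡⟨ sym (trans (neg1^-+ (a ℕ.+ ((b ℕ.+ c) ℕ.+ d)) e) (cong (_* neg1^ e) (trans (neg1^-+ a _) (cong (neg1^ a *_)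
             (trans (neg1^-+ (b ℕ.+ c) d) (cong (_* neg1^ d) (neg1^-+ b c))))))) ⟩
  neg1^ ((a ℕ.+ ((b ℕ.+ c) ℕ.+ d)) ℕ.+ e)
    ≡⟨ neg1^-≡ exponents ⟩
  neg1^ (Φ s u) ∎
  where
  open ≡-Reasoning
  u : Word m
  u = act π t
  ρ : Perm m
  ρ = π ⁻¹
  a b c d e : ℕ
  a = inversions s
  b = blockInversions s u
  c = inversions (permWord π)
  d = blockInversions t (act ρ s)
  e = inversions t
  -- Relabelling by ρ turns the arcs of lexGreater u s into those of lexGreater t (ρ s).
  second : e ℕ.+ d ℕ.+ c ≡₂ forwardArcs (lexGreater u s)
  second = ≡₂-trans
    (≡₂-reflexive (cong₂ ℕ._+_
      (trans (sym (forwardArcs-lexGreater t (act ρ s)))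
             (trans (forwardArcs-cong (lexGreater-cong {b = act ρ s} (λ k → sym (act-inverseˡ π t k)) (λ _ → refl)))
                    (forwardArcs-lexGreater-act ρ u s)))
      (sym (ascendingArcs⁻¹-reverse π))))
    (ascendingArcs-≡₂ ρ (lexGreater u s)
      (lexGreater-tournament u s (PairsDistinct-swap (SgnNonzero⇒PairsDistinct s u nz))))
  exponents : (a ℕ.+ ((b ℕ.+ c) ℕ.+ d)) ℕ.+ e ≡₂ Φ s u
  exponents = ≡₂-trans (≡₂-reflexive (solve 5 (λ a b c d e → (a :+ ((b :+ c) :+ d)) :+ e := (a :+ b) :+ ((e :+ d) :+ c)) refl a b c d e))
                       (+-cong-≡₂ (≡₂-reflexive (sym (forwardArcs-lexGreater s u))) second)
    where open +-*-Solver

-- Rearrangements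

module _ {A : Set} (_≟ᴬ_ : DecidableEquality A) where

  multiplicity : ∀ {m} → (Fin m → A) → A → ℕ
  multiplicity a c = sum (λ i → 𝟙 (does (a i ≟ᴬ c)))

  sameMultiplicities⇒rearrangement : ∀ {m} (a b : Fin m → A) → (∀ c → multiplicity a c ≡ multiplicity b c) →
    Σ (Perm m) λ π → ∀ i → b (π ⟨$⟩ʳ i) ≡ a i
  sameMultiplicities⇒rearrangement {zero}  a b same = P.id , λ ()
  sameMultiplicities⇒rearrangement {suc n} a b same = lift₀ (proj₁ tails) ∘ₚ τ , matched
    where
    a₀ : A
    a₀ = a F.zero
    -- τ brings an occurrence j of a₀ in b to the front; the tails are then matched recursively.
    occurrence : ∃ λ j → 1 ≤ 𝟙 (does (b j ≟ᴬ a₀))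
    occurrence = sum-pos⇒term-pos (λ i → 𝟙 (does (b i ≟ᴬ a₀)))
      (subst (1 ≤_) (same a₀) (term-pos⇒sum-pos (λ i → 𝟙 (does (a i ≟ᴬ a₀))) F.zero
        (subst (λ z → 1 ≤ 𝟙 z) (sym (dec-true (a₀ ≟ᴬ a₀) refl)) (s≤s z≤n))))
    j : Fin (suc n)
    j = proj₁ occurrence
    τ : Perm (suc n)
    τ = transpose F.zero j
    b′ : Fin (suc n) → A
    b′ i = b (τ ⟨$⟩ʳ i)
    b′₀≡a₀ : b′ F.zero ≡ a₀
    b′₀≡a₀ = 𝟙-does⇒ (b j ≟ᴬ a₀) (proj₂ occurrence)
    sameTails : ∀ c → multiplicity (a ∘ F.suc) c ≡ multiplicity (b′ ∘ F.suc) c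
    sameTails c = ℕP.+-cancelˡ-≡ (𝟙 (does (a₀ ≟ᴬ c))) _ _
      (trans (same c) (trans (∑-permute (λ i → 𝟙 (does (b i ≟ᴬ c))) τ)
        (cong (λ z → 𝟙 (does (z ≟ᴬ c)) ℕ.+ multiplicity (b′ ∘ F.suc) c) b′₀≡a₀)))
    tails : Σ (Perm n) λ π → ∀ i → (b′ ∘ F.suc) (π ⟨$⟩ʳ i) ≡ (a ∘ F.suc) i
    tails = sameMultiplicities⇒rearrangement (a ∘ F.suc) (b′ ∘ F.suc) sameTails
    matched : ∀ i → b ((lift₀ (proj₁ tails) ∘ₚ τ) ⟨$⟩ʳ i) ≡ a i
    matched F.zero    = b′₀≡a₀
    matched (F.suc i) = proj₂ tails i

  sameMultiplicities⇒act : ∀ {m} (a b : Fin m → A) → (∀ c → multiplicity a c ≡ multiplicity b c) →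
    Σ (Perm m) λ π → ∀ j → b j ≡ a (π ⟨$⟩ˡ j)
  sameMultiplicities⇒act a b same with sameMultiplicities⇒rearrangement a b same
  ... | π , rearranged = π , λ j → trans (cong b (sym (inverseʳ π))) (rearranged (π ⟨$⟩ˡ j))

sameCounts⇒act : ∀ {m} (a b : Word m) → (∀ c → count a c ≡ count b c) → Σ (Perm m) λ h → b ≗ act h a
sameCounts⇒act a b same = sameMultiplicities⇒act _≟_ a b (λ c → trans (sym (count≡sum a c)) (trans (same c) (count≡sum b c)))

-- Decides pairs componentwise, so that its multiplicities unfold to pairCount.
pair≟ : DecidableEquality (ℕ × ℕ)
pair≟ (x , y) (c , v) = map′ (λ (x≡c , y≡v) → cong₂ _,_ x≡c y≡v) (λ e → cong proj₁ e , cong proj₂ e) ((x ≟ c) ×-dec (y ≟ v))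

samePairCounts⇒act : ∀ {m} (s₀ u₀ s u : Word m) → (∀ c v → pairCount s₀ u₀ c v ≡ pairCount s u c v) →
  Σ (Perm m) λ h → s ≗ act h s₀ × u ≗ act h u₀
samePairCounts⇒act s₀ u₀ s u same with sameMultiplicities⇒act pair≟ (λ i → s₀ i , u₀ i) (λ i → s i , u i) (λ (c , v) → same c v)
... | h , matched = h , (λ j → cong proj₁ (matched j)) , (λ j → cong proj₂ (matched j))

-- Partitions and their conjugates

partsAtLeast : ℕ → List ℕ → ℕ
partsAtLeast b λ′ = length (filter (b ≤?_) λ′)

part≤ : ∀ {b} λ′ → All (_≤ b) λ′ → ∀ i → part λ′ i ≤ b
part≤ []       _        i       = z≤n
part≤ (_ ∷ _)  (p ∷ _)  zero    = p
part≤ (_ ∷ λ′) (_ ∷ ps) (suc i) = part≤ λ′ ps i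

part-pos⇒< : ∀ λ′ i → 1 ≤ part λ′ i → i < length λ′
part-pos⇒< (_ ∷ _)  zero    _   = s≤s z≤n
part-pos⇒< (_ ∷ λ′) (suc i) pos = s≤s (part-pos⇒< λ′ i pos)

length≤⇒part≡0 : ∀ λ′ i → length λ′ ≤ i → part λ′ i ≡ 0
length≤⇒part≡0 []       i       _         = refl
length≤⇒part≡0 (_ ∷ λ′) (suc i) (s≤s ℓ≤i) = length≤⇒part≡0 λ′ i ℓ≤i

part-map-upTo : ∀ (f : ℕ → ℕ) k i → i < k → part (map f (upTo k)) i ≡ f i
part-map-upTo f k i i<k = go f (λ j → j) k i i<k
  where
  go : ∀ (f g : ℕ → ℕ) k i → i < k → part (map f (applyUpTo g k)) i ≡ f (g i)
  go f g (suc k) zero    _         = refl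
  go f g (suc k) (suc i) (s≤s i<k) = go f (g ∘ suc) k i i<k

parts≤head : ∀ {x xs} → Linked _≥_ (x ∷ xs) → All (_≤ x) (x ∷ xs)
parts≤head = LinkedP.Linked⇒All (λ p q → ℕP.≤-trans q p) ℕP.≤-refl

partsAtLeast-none : ∀ b λ′ → All (_< b) λ′ → partsAtLeast b λ′ ≡ 0
partsAtLeast-none b λ′ parts<b = cong length (LP.filter-none (b ≤?_) (All.map ℕP.<⇒≱ parts<b))

<partsAtLeast⇔ : ∀ λ′ → Linked _≥_ λ′ → ∀ i b → (i < length λ′ × b ≤ part λ′ i) ⇔ i < partsAtLeast b λ′
<partsAtLeast⇔ []       _       i b = mk⇔ (λ ()) (λ ())
<partsAtLeast⇔ (x ∷ xs) sorted i b with b ≤? x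
... | yes b≤x rewrite LP.filter-accept (b ≤?_) {xs = xs} b≤x = mk⇔ (to i) (from i)
  where
  tail⇔ : ∀ i b → (i < length xs × b ≤ part xs i) ⇔ i < partsAtLeast b xs
  tail⇔ = <partsAtLeast⇔ xs (Linked.tail sorted)
  to : ∀ i → i < suc (length xs) × b ≤ part (x ∷ xs) i → i < suc (partsAtLeast b xs)
  to zero    _                  = s≤s z≤n
  to (suc i) (s≤s i<ℓ , b≤λᵢ)   = s≤s (Equivalence.to (tail⇔ i b) (i<ℓ , b≤λᵢ))
  from : ∀ i → i < suc (partsAtLeast b xs) → i < suc (length xs) × b ≤ part (x ∷ xs) i
  from zero    _       = s≤s z≤n , b≤x
  from (suc i) (s≤s i<) with Equivalence.from (tail⇔ i b) i<
  ... | i<ℓ , b≤λᵢ = s≤s i<ℓ , b≤λᵢ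
... | no b≰x rewrite LP.filter-reject (b ≤?_) {xs = xs} b≰x = mk⇔ to from
  where
  none : partsAtLeast b xs ≡ 0
  none = partsAtLeast-none b xs (All.tail (All.map (λ q → ℕP.≤-<-trans q (ℕP.≰⇒> b≰x)) (parts≤head sorted)))
  to : i < suc (length xs) × b ≤ part (x ∷ xs) i → i < partsAtLeast b xs
  to (_ , b≤λᵢ) = ⊥-elim (b≰x (ℕP.≤-trans b≤λᵢ (part≤ (x ∷ xs) (parts≤head sorted) i)))
  from : i < partsAtLeast b xs → i < suc (length xs) × b ≤ part (x ∷ xs) i
  from i< with subst (i <_) none i<
  ... | ()

letterMult-conj : ∀ λ′ → Linked _≥_ λ′ → ∀ v → letterMult (conj λ′) (suc v) ≡ partsAtLeast (suc v) λ′
letterMult-conj λ′ sorted v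
  rewrite sym (LP.map-∘ {g = λ j → partsAtLeast j λ′} {f = suc} (upTo (firstPart λ′))) with v <? firstPart λ′
... | yes v<λ₁ = part-map-upTo (λ j → partsAtLeast (suc j) λ′) (firstPart λ′) v v<λ₁
... | no v≮λ₁  = trans (length≤⇒part≡0 conjList v (subst (_≤ v) (sym length-conjList) (ℕP.≮⇒≥ v≮λ₁)))
                      (sym (partsAtLeast-none (suc v) λ′ (parts≤v λ′ sorted (ℕP.≮⇒≥ v≮λ₁))))
  where
  parts≤v : ∀ μ → Linked _≥_ μ → firstPart μ ≤ v → All (_< suc v) μ
  parts≤v []      _       _     = []
  parts≤v (_ ∷ _) sorted′ λ₁≤v = All.map (λ y≤λ₁ → s≤s (ℕP.≤-trans y≤λ₁ λ₁≤v)) (parts≤head sorted′)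
  conjList : List ℕ
  conjList = map (λ j → partsAtLeast (suc j) λ′) (upTo (firstPart λ′))
  length-conjList : length conjList ≡ firstPart λ′
  length-conjList = trans (LP.length-map (λ j → partsAtLeast (suc j) λ′) (upTo (firstPart λ′))) (LP.length-applyUpTo _ (firstPart λ′))

InD⇔inRow : ∀ λ′ c v → (1 ≤ letterMult λ′ c × 1 ≤ v × v ≤ letterMult λ′ c) ⇔ InD λ′ c v
InD⇔inRow λ′ c v = mk⇔ (to c) (λ (_ , _ , 1≤v , v≤) → ℕP.≤-trans 1≤v v≤ , 1≤v , v≤)
  where
  to : ∀ c → 1 ≤ letterMult λ′ c × 1 ≤ v × v ≤ letterMult λ′ c → InD λ′ c v
  to (suc i) (λᵢ-pos , 1≤v , v≤) = s≤s z≤n , part-pos⇒< λ′ i λᵢ-pos , 1≤v , v≤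

InD⇔inColumn : ∀ λ′ → Linked _≥_ λ′ → ∀ c v →
  (1 ≤ letterMult (conj λ′) v × 1 ≤ c × c ≤ letterMult (conj λ′) v) ⇔ InD λ′ c v
InD⇔inColumn λ′ sorted c zero = mk⇔ (λ { (() , _) }) (λ { (_ , _ , () , _) })
InD⇔inColumn λ′ sorted c (suc v) rewrite letterMult-conj λ′ sorted v = mk⇔ (to c) (from c)
  where
  to : ∀ c → 1 ≤ partsAtLeast (suc v) λ′ × 1 ≤ c × c ≤ partsAtLeast (suc v) λ′ → InD λ′ c (suc v)
  to (suc i) (_ , _ , i<) with Equivalence.from (<partsAtLeast⇔ λ′ sorted i (suc v)) i<
  ... | i<ℓ , v<λᵢ = s≤s z≤n , i<ℓ , s≤s z≤n , v<λᵢ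
  from : ∀ c → InD λ′ c (suc v) → 1 ≤ partsAtLeast (suc v) λ′ × 1 ≤ c × c ≤ partsAtLeast (suc v) λ′
  from (suc i) (_ , i<ℓ , _ , v<λᵢ) = ℕP.≤-trans (s≤s z≤n) i< , s≤s z≤n , i<
    where
    i< : i < partsAtLeast (suc v) λ′
    i< = Equivalence.to (<partsAtLeast⇔ λ′ sorted i (suc v)) (i<ℓ , v<λᵢ)

-- The cells of a Young diagram, read row by row

rowCells : ℕ → ℕ → List (ℕ × ℕ)
rowCells r k = map (r ,_) (oneTo k)

cellsFrom : ℕ → List ℕ → List (ℕ × ℕ)
cellsFrom r []       = []
cellsFrom r (k ∷ λ′) = rowCells r k ++ cellsFrom (suc r) λ′

length-cellsFrom : ∀ r λ′ → length (cellsFrom r λ′) ≡ ∑ˡ λ′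
length-cellsFrom r []       = refl
length-cellsFrom r (k ∷ λ′) = trans (LP.length-++ (rowCells r k)) (cong₂ ℕ._+_ rowLength (length-cellsFrom (suc r) λ′))
  where
  rowLength : length (rowCells r k) ≡ k
  rowLength = trans (LP.length-map _ (oneTo k)) (trans (LP.length-map suc (upTo k)) (LP.length-applyUpTo (λ x → x) k))

∑ˡ-map-++ : ∀ {A : Set} (g : A → ℕ) xs ys → ∑ˡ (map g (xs ++ ys)) ≡ ∑ˡ (map g xs) ℕ.+ ∑ˡ (map g ys)
∑ˡ-map-++ g xs ys = trans (cong ∑ˡ (LP.map-++ g xs ys)) (ListActionP.sum-++ (map g xs) (map g ys))

∑ˡ-map-rowCells : ∀ (g : ℕ × ℕ → ℕ) r k → ∑ˡ (map g (rowCells r k)) ≡ sum {k} (λ j → g (r , suc (toℕ j)))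
∑ˡ-map-rowCells g r k =
  trans (cong ∑ˡ (trans (sym (LP.map-∘ (oneTo k))) (sym (LP.map-∘ (upTo k))))) (upTo-sum (λ j → g (r , suc j)) (λ x → x) k)
  where
  upTo-sum : ∀ (h : ℕ → ℕ) (f : ℕ → ℕ) k → ∑ˡ (map h (applyUpTo f k)) ≡ sum {k} (λ j → h (f (toℕ j)))
  upTo-sum h f zero    = refl
  upTo-sum h f (suc k) = cong (h (f 0) ℕ.+_) (upTo-sum h (f ∘ suc) k)

rowCount-below : ∀ λ′ r c → c < r → ∑ˡ (map (λ p → 𝟙 (does (proj₁ p ≟ c))) (cellsFrom r λ′)) ≡ 0
rowCount-below []       r c c<r = refl
rowCount-below (k ∷ λ′) r c c<r = trans (∑ˡ-map-++ _ (rowCells r k) _)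
  (cong₂ ℕ._+_ (trans (∑ˡ-map-rowCells _ r k)
                      (trans (sum-cong-≗ {k} (λ _ → cong 𝟙 (dec-false (r ≟ c) (λ r≡c → ℕP.<-irrefl (sym r≡c) c<r)))) (sum-replicate-zero k)))
               (rowCount-below λ′ (suc r) c (ℕP.m<n⇒m<1+n c<r)))

rowCount : ∀ λ′ r i → ∑ˡ (map (λ p → 𝟙 (does (proj₁ p ≟ r ℕ.+ i))) (cellsFrom r λ′)) ≡ part λ′ i
rowCount []       r i       = refl
rowCount (k ∷ λ′) r zero    = trans (∑ˡ-map-++ _ (rowCells r k) _)
  (trans (cong₂ ℕ._+_ (trans (∑ˡ-map-rowCells _ r k)
                             (trans (sum-cong-≗ {k} (λ _ → cong 𝟙 (dec-true (r ≟ r ℕ.+ 0) (sym (ℕP.+-identityʳ r))))) (sum-ones k)))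
                      (rowCount-below λ′ (suc r) (r ℕ.+ 0) (s≤s (ℕP.≤-reflexive (ℕP.+-identityʳ r)))))
         (ℕP.+-identityʳ k))
rowCount (k ∷ λ′) r (suc i) = trans (∑ˡ-map-++ _ (rowCells r k) _)
  (cong₂ ℕ._+_ (trans (∑ˡ-map-rowCells _ r k)
                      (trans (sum-cong-≗ {k} (λ _ → cong 𝟙 (dec-false (r ≟ r ℕ.+ suc i) (λ e → ℕP.<-irrefl e (ℕP.m<m+n r (s≤s z≤n))))))
                             (sum-replicate-zero k)))
               (trans (cong (λ z → ∑ˡ (map (λ p → 𝟙 (does (proj₁ p ≟ z))) (cellsFrom (suc r) λ′))) (ℕP.+-suc r i))
                      (rowCount λ′ (suc r) i)))

partsAtLeast-∷ : ∀ b k λ′ → partsAtLeast b (k ∷ λ′) ≡ 𝟙 (does (b ≤? k)) ℕ.+ partsAtLeast b λ′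
partsAtLeast-∷ b k λ′ = byCases (b ≤? k)
  where
  byCases : Dec (b ≤ k) → partsAtLeast b (k ∷ λ′) ≡ 𝟙 (does (b ≤? k)) ℕ.+ partsAtLeast b λ′
  byCases (yes b≤k) rewrite LP.filter-accept (b ≤?_) {xs = λ′} b≤k | dec-true (b ≤? k) b≤k = refl
  byCases (no b≰k)  rewrite LP.filter-reject (b ≤?_) {xs = λ′} b≰k | dec-false (b ≤? k) b≰k = refl

columnCount : ∀ λ′ r v → ∑ˡ (map (λ p → 𝟙 (does (proj₂ p ≟ suc v))) (cellsFrom r λ′)) ≡ partsAtLeast (suc v) λ′
columnCount []       r v = refl
columnCount (k ∷ λ′) r v = trans (∑ˡ-map-++ _ (rowCells r k) _)
  (trans (cong₂ ℕ._+_ (trans (∑ˡ-map-rowCells _ r k)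
                             (trans (sum-cong-≗ {k} (λ j → cong 𝟙 (does-≟-sym (suc (toℕ j)) (suc v)))) (sum-𝟙-≟-shift k 1 (suc v))))
                      (columnCount λ′ (suc r) v))
         (sym (partsAtLeast-∷ (suc v) k λ′)))

columnCount-zero : ∀ λ′ r → ∑ˡ (map (λ p → 𝟙 (does (proj₂ p ≟ 0))) (cellsFrom r λ′)) ≡ 0
columnCount-zero []       r = refl
columnCount-zero (k ∷ λ′) r = trans (∑ˡ-map-++ _ (rowCells r k) _)
  (cong₂ ℕ._+_ (trans (∑ˡ-map-rowCells _ r k) (sum-replicate-zero k)) (columnCount-zero λ′ (suc r)))

∈-cellsFrom : ∀ λ′ r i v → i < length λ′ → 1 ≤ v → v ≤ part λ′ i → (r ℕ.+ i , v) ∈ cellsFrom r λ′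
∈-cellsFrom (k ∷ λ′) r zero (suc v) _ _ v<k = MP.∈-++⁺ˡ
  (subst (λ z → (z , suc v) ∈ rowCells r k) (sym (ℕP.+-identityʳ r))
         (MP.∈-map⁺ (r ,_) (MP.∈-map⁺ suc (MP.∈-applyUpTo⁺ (λ x → x) v<k))))
∈-cellsFrom (k ∷ λ′) r (suc i) v (s≤s i<ℓ) 1≤v v≤ = MP.∈-++⁺ʳ (rowCells r k)
  (subst (λ z → (z , v) ∈ cellsFrom (suc r) λ′) (sym (ℕP.+-suc r i)) (∈-cellsFrom λ′ (suc r) i v i<ℓ 1≤v v≤))

LexLess : ℕ × ℕ → ℕ × ℕ → Set
LexLess (a , b) (c , d) = a < c ⊎ (a ≡ c × b < d)

LexLess⇒≤ : ∀ {p q} → LexLess p q → proj₁ p ≤ proj₁ q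
LexLess⇒≤ (inj₁ p<q)       = ℕP.<⇒≤ p<q
LexLess⇒≤ (inj₂ (p≡q , _)) = ℕP.≤-reflexive p≡q

cellsFrom-sorted : ∀ λ′ r → AllPairs LexLess (cellsFrom r λ′)
cellsFrom-sorted []       r = []
cellsFrom-sorted (k ∷ λ′) r = AllPairsP.++⁺ rowSorted (cellsFrom-sorted λ′ (suc r))
  (AllP.map⁺ (All.universal (λ _ → All.map inj₁ (laterRows λ′ (suc r) ℕP.≤-refl)) (oneTo k)))
  where
  rowSorted : AllPairs LexLess (rowCells r k)
  rowSorted = AllPairsP.map⁺ (AllPairsP.map⁺ (AllPairsP.applyUpTo⁺₁ (λ x → x) k (λ i<j _ → inj₂ (refl , s≤s i<j))))
  laterRows : ∀ μ r′ → suc r ≤ r′ → All (λ p → r < proj₁ p) (cellsFrom r′ μ)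
  laterRows []      r′ _   = []
  laterRows (k′ ∷ μ) r′ r<r′ = AllP.++⁺ (AllP.map⁺ (All.universal (λ _ → r<r′) (oneTo k′)))
                                        (laterRows μ (suc r′) (ℕP.m≤n⇒m≤1+n r<r′))

lookup-AllPairs : ∀ {A : Set} {R : A → A → Set} {xs : List A} → AllPairs R xs →
  (k l : Fin (length xs)) → toℕ k < toℕ l → R (lookup xs k) (lookup xs l)
lookup-AllPairs {xs = _ ∷ xs} (Rx ∷ _)  F.zero    (F.suc l) _         = All.lookup Rx (MP.∈-lookup {xs = xs} l)
lookup-AllPairs {xs = _ ∷ _}  (_ ∷ Rxs) (F.suc k) (F.suc l) (s≤s k<l) = lookup-AllPairs Rxs k l k<l

map-proj₂-cellsFrom : ∀ λ′ r → map proj₂ (cellsFrom r λ′) ≡ concatMap oneTo λ′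
map-proj₂-cellsFrom []       r = refl
map-proj₂-cellsFrom (k ∷ λ′) r = trans (LP.map-++ proj₂ (rowCells r k) (cellsFrom (suc r) λ′))
  (cong₂ _++_ (trans (sym (LP.map-∘ (oneTo k))) (LP.map-id (oneTo k))) (map-proj₂-cellsFrom λ′ (suc r)))

sum-lookup : ∀ {A : Set} (xs : List A) {n} (n≡ : n ≡ length xs) (f : A → ℕ) →
  sum {n} (λ i → f (lookup xs (F.cast n≡ i))) ≡ ∑ˡ (map f xs)
sum-lookup xs refl f = trans (sum-cong-≗ {length xs} (λ i → cong (f ∘ lookup xs) (FP.cast-is-id refl i))) (go xs)
  where
  go : ∀ xs → sum (λ i → f (lookup xs i)) ≡ ∑ˡ (map f xs)
  go []       = refl
  go (x ∷ xs) = cong (f x ℕ.+_) (go xs)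

tabulate-lookup : ∀ {A B : Set} (xs : List A) {n} (n≡ : n ≡ length xs) (f : A → B) →
  tabulate (λ i → f (lookup xs (F.cast n≡ i))) ≡ map f xs
tabulate-lookup xs refl f = trans (LP.tabulate-cong (λ i → cong (f ∘ lookup xs) (FP.cast-is-id refl i)))
  (trans (sym (LP.map-tabulate (lookup xs) f)) (cong (map f) (LP.tabulate-lookup xs)))

-- s₀ and u₀ list the row and the column of each cell of D(λ), the cells read row by row.
module CanonicalPair (λ′ : List ℕ) {m} (size : ∑ˡ λ′ ≡ m) (decreasing : Linked _≥_ λ′) where

  cells : List (ℕ × ℕ)
  cells = cellsFrom 1 λ′

  m≡ : m ≡ length cells
  m≡ = sym (trans (length-cellsFrom 1 λ′) size)

  cell : Fin m → ℕ × ℕ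
  cell i = lookup cells (F.cast m≡ i)

  s₀ u₀ : Word m
  s₀ = proj₁ ∘ cell
  u₀ = proj₂ ∘ cell

  s₀∈A : InA λ′ s₀
  s₀∈A c = trans (count≡sum s₀ c) (trans (sum-lookup cells m≡ (λ p → 𝟙 (does (proj₁ p ≟ c)))) (rows c))
    where
    rows : ∀ c → ∑ˡ (map (λ p → 𝟙 (does (proj₁ p ≟ c))) cells) ≡ letterMult λ′ c
    rows zero    = rowCount-below λ′ 1 0 (s≤s z≤n)
    rows (suc i) = rowCount λ′ 1 i

  u₀∈A : InA (conj λ′) u₀
  u₀∈A v = trans (count≡sum u₀ v) (trans (sum-lookup cells m≡ (λ p → 𝟙 (does (proj₂ p ≟ v)))) (columns v))
    where
    columns : ∀ v → ∑ˡ (map (λ p → 𝟙 (does (proj₂ p ≟ v))) cells) ≡ letterMult (conj λ′) v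
    columns zero    = columnCount-zero λ′ 1
    columns (suc v) = trans (columnCount λ′ 1 v) (sym (letterMult-conj λ′ decreasing v))

  uniquePairs : UniquePairs s₀ u₀
  uniquePairs = allPairsOccur⇒UniquePairs s₀ u₀ λ i v 1≤v v≤ → occurs (s₀ i) refl (subst (v ≤_) (s₀∈A (s₀ i)) v≤) 1≤v
    where
    occurs : ∀ {i v} c → s₀ i ≡ c → v ≤ letterMult λ′ c → 1 ≤ v → ∃ λ j → s₀ j ≡ s₀ i × u₀ j ≡ v
    occurs zero    _    v≤ 1≤v = ⊥-elim (ℕP.<-irrefl refl (ℕP.≤-trans 1≤v v≤))
    occurs {v = v} (suc r) s₀ᵢ≡ v≤ 1≤v = j , trans (cong proj₁ cellⱼ) (sym s₀ᵢ≡) , cong proj₂ cellⱼ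
      where
      cell∈ : (suc r , v) ∈ cells
      cell∈ = ∈-cellsFrom λ′ 1 r v (part-pos⇒< λ′ r (ℕP.≤-trans 1≤v v≤)) 1≤v v≤
      j : Fin m
      j = F.cast (sym m≡) (Any.index cell∈)
      cellⱼ : cell j ≡ (suc r , v)
      cellⱼ = trans (cong (lookup cells) (FP.cast-involutive m≡ (sym m≡) (Any.index cell∈))) (sym (AnyP.lookup-index cell∈))

  sorted : ∀ k l → toℕ k < toℕ l → LexLess (cell k) (cell l)
  sorted k l k<l = lookup-AllPairs (cellsFrom-sorted λ′ 1) (F.cast m≡ k) (F.cast m≡ l)
    (subst₂ _<_ (sym (FP.toℕ-cast m≡ k)) (sym (FP.toℕ-cast m≡ l)) k<l)

  signPartition≡ : signPartition λ′ ≡ neg1^ (inversions u₀)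
  signPartition≡ = trans (cong (neg1^ ∘ inv) (sym wordList-u₀)) (signWord≡neg1^inversions u₀)
    where
    wordList-u₀ : wordList u₀ ≡ concatMap oneTo λ′
    wordList-u₀ = trans (LP.map-tabulate (λ i → i) u₀) (trans (tabulate-lookup cells m≡ proj₂) (map-proj₂-cellsFrom λ′ 1))

  -- Reading order is lexicographic in (s₀, u₀), so only the inversions of u₀ survive in Φ.
  Φ≡inversions : Φ s₀ u₀ ≡ inversions u₀
  Φ≡inversions = cong₂ ℕ._+_ (∑∑-zero _ noLexDescent)
    (trans (forwardArcs-lexGreater u₀ s₀) (trans (cong (inversions u₀ ℕ.+_) (∑∑-zero _ noBlockInversion)) (ℕP.+-identityʳ _)))
    where
    noLexDescent : ∀ k l → 𝟙 (k <ᵇ l ∧ lexGreater s₀ u₀ k l) ≡ 0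
    noLexDescent k l with k <ᵇ l in k<l
    ... | false = refl
    ... | true with sorted k l (<ᵇ⇒< k l k<l)
    ...   | inj₁ s₀ₖ<s₀ₗ rewrite dec-false (s₀ l <? s₀ k) (ℕP.<-asym s₀ₖ<s₀ₗ)
                             | dec-false (s₀ k ≟ s₀ l) (λ e → ℕP.<-irrefl e s₀ₖ<s₀ₗ) = refl
    ...   | inj₂ (s₀ₖ≡s₀ₗ , u₀ₖ<u₀ₗ) rewrite dec-false (s₀ l <? s₀ k) (ℕP.<-irrefl (sym s₀ₖ≡s₀ₗ))
                                      | dec-false (u₀ l <? u₀ k) (ℕP.<-asym u₀ₖ<u₀ₗ) =
      cong 𝟙 (∧-zeroʳ (does (s₀ k ≟ s₀ l)))
    noBlockInversion : ∀ k l → 𝟙 (k <ᵇ l ∧ (does (u₀ k ≟ u₀ l) ∧ does (s₀ l <? s₀ k))) ≡ 0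
    noBlockInversion k l with k <ᵇ l in k<l
    ... | false = refl
    ... | true rewrite dec-false (s₀ l <? s₀ k) (ℕP.≤⇒≯ (LexLess⇒≤ (sorted k l (<ᵇ⇒< k l k<l)))) =
      cong 𝟙 (∧-zeroʳ (does (u₀ k ≟ u₀ l)))

-- Nonvanishing of sgn_s in terms of pairs

pairCount-inRange : ∀ {m} (a x : Word m) → UniquePairs a x → ∀ c v → 1 ≤ v → v ≤ count a c → pairCount a x c v ≡ 1
pairCount-inRange a x unique c v 1≤v v≤ with count-pos⇒∃ a c (ℕP.≤-trans 1≤v v≤)
... | i , refl = unique i v 1≤v v≤

pairCount-outOfRange : ∀ {m} (a x : Word m) → UniquePairs a x → ∀ c v → ¬ (1 ≤ v × v ≤ count a c) → pairCount a x c v ≡ 0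
pairCount-outOfRange a x unique c v out with pairCount a x c v in eq
... | zero  = refl
... | suc _ with pairCount-pos⇒∃ a x c v (subst (1 ≤_) (sym eq) (s≤s z≤n))
...   | i , refl , refl = ⊥-elim (out (UniquePairs⇒inRange a x unique i))

UniquePairs⇒samePairCounts : ∀ {m} (a x a′ x′ : Word m) → UniquePairs a x → UniquePairs a′ x′ →
  (∀ c → count a c ≡ count a′ c) → ∀ c v → pairCount a x c v ≡ pairCount a′ x′ c v
UniquePairs⇒samePairCounts a x a′ x′ unique unique′ same c v with (1 ≤? v) ×-dec (v ≤? count a c)
... | yes (1≤v , v≤) = trans (pairCount-inRange a x unique c v 1≤v v≤)
                             (sym (pairCount-inRange a′ x′ unique′ c v 1≤v (subst (v ≤_) (same c) v≤)))
... | no out = trans (pairCount-outOfRange a x unique c v out)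
                     (sym (pairCount-outOfRange a′ x′ unique′ c v (λ (1≤v , v≤) → out (1≤v , subst (v ≤_) (sym (same c)) v≤))))

SgnNonzero⇔pairsFillRows : ∀ {m} (a x : Word m) →
  SgnNonzero a x ⇔ (∀ c v → (∃ λ i → a i ≡ c × x i ≡ v) ⇔ (1 ≤ count a c × 1 ≤ v × v ≤ count a c))
SgnNonzero⇔pairsFillRows a x = ⇔.trans (SgnNonzero⇔UniquePairs a x) (mk⇔ to from)
  where
  to : UniquePairs a x → ∀ c v → (∃ λ i → a i ≡ c × x i ≡ v) ⇔ (1 ≤ count a c × 1 ≤ v × v ≤ count a c)
  to unique c v = mk⇔
    (λ { (i , refl , refl) → let (1≤xᵢ , xᵢ≤) = UniquePairs⇒inRange a x unique i in ℕP.≤-trans 1≤xᵢ xᵢ≤ , 1≤xᵢ , xᵢ≤ })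
    (λ (_ , 1≤v , v≤) → pairCount-pos⇒∃ a x c v (ℕP.≤-reflexive (sym (pairCount-inRange a x unique c v 1≤v v≤))))
  from : (∀ c v → (∃ λ i → a i ≡ c × x i ≡ v) ⇔ (1 ≤ count a c × 1 ≤ v × v ≤ count a c)) → UniquePairs a x
  from pairs = allPairsOccur⇒UniquePairs a x (λ i v 1≤v v≤ → Equivalence.from (pairs (a i) v) (ℕP.≤-trans 1≤v v≤ , 1≤v , v≤))

PairsFormD : ∀ {m} → List ℕ → Word m → Word m → Set
PairsFormD λ′ s t = ∀ a b → (∃ λ i → s i ≡ a × t i ≡ b) ⇔ InD λ′ a b

SgnNonzero⇔PairsFormD : ∀ {m} λ′ (s t : Word m) → InA λ′ s → SgnNonzero s t ⇔ PairsFormD λ′ s t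
SgnNonzero⇔PairsFormD λ′ s t s∈A = ⇔.trans (SgnNonzero⇔pairsFillRows s t)
  (mk⇔ (λ pairs a b → ⇔.trans (pairs a b) (rows a b)) (λ pairs a b → ⇔.trans (pairs a b) (⇔.sym (rows a b))))
  where
  rows : ∀ a b → (1 ≤ count s a × 1 ≤ b × b ≤ count s a) ⇔ InD λ′ a b
  rows a b rewrite s∈A a = InD⇔inRow λ′ a b

SgnNonzero-conj⇔PairsFormD : ∀ {m} λ′ → Linked _≥_ λ′ → (s t : Word m) → InA (conj λ′) t → SgnNonzero t s ⇔ PairsFormD λ′ s t
SgnNonzero-conj⇔PairsFormD λ′ decreasing s t t∈A = ⇔.trans (SgnNonzero⇔pairsFillRows t s)
  (mk⇔ (λ pairs a b → ⇔.trans swap (⇔.trans (pairs b a) (columns a b)))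
       (λ pairs b a → ⇔.trans (⇔.sym swap) (⇔.trans (pairs a b) (⇔.sym (columns a b)))))
  where
  swap : ∀ {a b} → (∃ λ i → s i ≡ a × t i ≡ b) ⇔ (∃ λ i → t i ≡ b × s i ≡ a)
  swap = mk⇔ (λ (i , p , q) → i , q , p) (λ (i , p , q) → i , q , p)
  columns : ∀ a b → (1 ≤ count t b × 1 ≤ a × a ≤ count t b) ⇔ InD λ′ a b
  columns a b rewrite t∈A b = InD⇔inColumn λ′ decreasing a b

SgnNonzero-act⇔ : ∀ {m} (s t : Word m) h → SgnNonzero s t ⇔ SgnNonzero (act h s) (act h t)
SgnNonzero-act⇔ s t h = mk⇔ (SgnNonzero-act h s t)
  (SgnNonzero-cong (act-inverseˡ h s) (act-inverseˡ h t) ∘ SgnNonzero-act (h ⁻¹) (act h s) (act h t))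

act-doubleCoset : ∀ {m} (t : Word m) h x y w → InY t y → w ≈ₚ ((x · h) · y) → act w t ≗ act x (act h t)
act-doubleCoset t h x y w y∈Yₜ w≈ j = trans (act-cong {σ = w} {τ = (x · h) · y} t w≈ j) (y∈Yₜ (h ⟨$⟩ˡ (x ⟨$⟩ˡ j)))

sgnS-doubleCoset : ∀ {m} (s t : Word m) h x y w → InG s t h → InY s x → InY t y → w ≈ₚ ((x · h) · y) →
  sgnS s (act w t) ≡ signPerm x * sgnS s (act h t)
sgnS-doubleCoset s t h x y w h∈G x∈Yₛ y∈Yₜ w≈ =
  trans (sgnS-cong s (act-doubleCoset t h x y w y∈Yₜ w≈)) (sgnS-act-stabiliser s (act h t) x x∈Yₛ h∈G)

-- Words of contents λ and λ′

module ShapePair {m} (λ′ : List ℕ) (λ⊢m : IsPartition m λ′) (s t : Word m) (s∈A : InA λ′ s) (t∈A : InA (conj λ′) t) where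

  decreasing : Linked _≥_ λ′
  decreasing = proj₂ (proj₂ λ⊢m)

  open CanonicalPair λ′ (proj₁ λ⊢m) decreasing

  -- Both conditions say that the pairs (s′ i, t′ i) form D(λ).
  SgnNonzero-swap : ∀ {s′ t′ : Word m} → InA λ′ s′ → InA (conj λ′) t′ → SgnNonzero s′ t′ ⇔ SgnNonzero t′ s′
  SgnNonzero-swap {s′} {t′} s′∈A t′∈A =
    ⇔.trans (SgnNonzero⇔PairsFormD λ′ s′ t′ s′∈A) (⇔.sym (SgnNonzero-conj⇔PairsFormD λ′ decreasing s′ t′ t′∈A))

  G⇔G⁻¹ : ∀ w → InG s t w ⇔ InG t s (w ⁻¹)
  G⇔G⁻¹ w = ⇔.trans (SgnNonzero-swap s∈A (InA-act w t t∈A)) (⇔.trans (SgnNonzero-act⇔ (act w t) s (w ⁻¹))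
    (mk⇔ (SgnNonzero-cong (act-inverseˡ w t) (λ _ → refl)) (SgnNonzero-cong (λ j → sym (act-inverseˡ w t j)) (λ _ → refl))))

  -- Transport the canonical pair onto s, then t onto the image of u₀.
  G-element : Σ (Perm m) (InG s t)
  G-element = h₂ , SgnNonzero-cong (λ _ → refl) (proj₂ t≗)
    (Equivalence.from (SgnNonzero⇔UniquePairs s u)
      (UniquePairs-cong {x = u} (λ j → sym (proj₂ s≗ j)) (λ _ → refl) (UniquePairs-act h₁ s₀ u₀ uniquePairs)))
    where
    s≗ : Σ (Perm m) λ h → s ≗ act h s₀
    s≗ = sameCounts⇒act s₀ s (λ c → trans (s₀∈A c) (sym (s∈A c)))
    h₁ : Perm m
    h₁ = proj₁ s≗
    u : Word m
    u = act h₁ u₀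
    t≗ : Σ (Perm m) λ h → u ≗ act h t
    t≗ = sameCounts⇒act t u (λ v → trans (t∈A v) (sym (trans (count-act h₁ u₀ v) (u₀∈A v))))
    h₂ : Perm m
    h₂ = proj₁ t≗

  h : Perm m
  h = proj₁ G-element

  G≡doubleCoset : ∀ w → InG s t w ⇔ (Σ (Perm m) λ x → Σ (Perm m) λ y → InY s x × InY t y × (w ≈ₚ ((x · h) · y)))
  G≡doubleCoset w = mk⇔ to from
    where
    to : InG s t w → Σ (Perm m) λ x → Σ (Perm m) λ y → InY s x × InY t y × (w ≈ₚ ((x · h) · y))
    to w∈G = x , y , (λ j → sym (proj₁ (proj₂ matched) j)) , y∈Yₜ , w≈
      where
      -- s and wt have the same pairs as s and ht, so some x ∈ Y_s carries ht to wt.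
      matched : Σ (Perm m) λ x → s ≗ act x s × act w t ≗ act x (act h t)
      matched = samePairCounts⇒act s (act h t) s (act w t)
        (UniquePairs⇒samePairCounts s (act h t) s (act w t)
          (Equivalence.to (SgnNonzero⇔UniquePairs _ _) (proj₂ G-element))
          (Equivalence.to (SgnNonzero⇔UniquePairs _ _) w∈G) (λ _ → refl))
      x : Perm m
      x = proj₁ matched
      y : Perm m
      y = ((x · h) ⁻¹) · w
      y∈Yₜ : InY t y
      y∈Yₜ j = trans (proj₂ (proj₂ matched) (x ⟨$⟩ʳ (h ⟨$⟩ʳ j))) (trans (cong (act h t) (inverseˡ x)) (cong t (inverseˡ h)))
      w≈ : w ≈ₚ ((x · h) · y)
      w≈ i = sym (trans (cong (x ⟨$⟩ʳ_) (inverseʳ h)) (inverseʳ x))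
    from : (Σ (Perm m) λ x → Σ (Perm m) λ y → InY s x × InY t y × (w ≈ₚ ((x · h) · y))) → InG s t w
    from (x , y , x∈Yₛ , y∈Yₜ , w≈) = SgnNonzero-cong (λ _ → refl) (λ j → sym (act-doubleCoset t h x y w y∈Yₜ w≈ j))
      (SgnNonzero-cong x∈Yₛ (λ _ → refl) (SgnNonzero-act x s (act h t) (proj₂ G-element)))

  f≡signPartition : ∀ π → InG s t π → signWord s * signG s t π * signWord t ≡ signPartition λ′
  f≡signPartition π π∈G = begin
    signWord s * signG s t π * signWord t ≡⟨ f≡neg1^Φ s t π π∈G (Equivalence.to (G⇔G⁻¹ π) π∈G) ⟩
    neg1^ (Φ s (act π t))                 ≡⟨ neg1^-≡ (Φ-act-≡₂ s₀ u₀ s (act π t) g (UniquePairs⇒PairsDistinct s₀ u₀ uniquePairs)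
                                                              (proj₁ (proj₂ matched)) (proj₂ (proj₂ matched))) ⟩
    neg1^ (Φ s₀ u₀)                       ≡⟨ cong neg1^ Φ≡inversions ⟩
    neg1^ (inversions u₀)                 ≡⟨ sym signPartition≡ ⟩
    signPartition λ′                      ∎
    where
    open ≡-Reasoning
    matched : Σ (Perm m) λ g → s ≗ act g s₀ × act π t ≗ act g u₀
    matched = samePairCounts⇒act s₀ u₀ s (act π t)
      (UniquePairs⇒samePairCounts s₀ u₀ s (act π t) uniquePairs (Equivalence.to (SgnNonzero⇔UniquePairs _ _) π∈G)
        (λ c → trans (s₀∈A c) (sym (s∈A c))))
    g : Perm m
    g = proj₁ matched

  signG-unique : ∀ π π′ → InG s t π → InG s t π′ → signG s t π ≡ signG s t π′
  signG-unique π π′ π∈G π′∈G = cancel-involutions (signWord s) (signWord t) _ _ (signWord² s) (signWord² t)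
    (trans (f≡signPartition π π∈G) (sym (f≡signPartition π′ π′∈G)))
    where
    signWord² : ∀ (w : Word m) → signWord w * signWord w ≡ + 1
    signWord² w = trans (cong₂ _*_ (signWord≡neg1^inversions w) (signWord≡neg1^inversions w)) (neg1^-*-self (inversions w))

mainTheorem11 : (m : ℕ) (λ′ : List ℕ) → IsPartition m λ′ →
    (s t : Word m) → InA λ′ s → InA (conj λ′) t →
    ((Σ (Perm m) λ h → ∀ w → InG s t w ⇔
        (Σ (Perm m) λ x → Σ (Perm m) λ y → InY s x × InY t y × (w ≈ₚ ((x · h) · y))))
     × (∀ h x y w → InG s t h → InY s x → InY t y → w ≈ₚ ((x · h) · y) →
        sgnS s (act w t) ≡ signPerm x * sgnS s (act h t)))
    × ((sgnS s t ≢ + 0 ⇔ sgnS t s ≢ + 0)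
       × (sgnS t s ≢ + 0 ⇔ (∀ a b → (∃ λ i → s i ≡ a × t i ≡ b) ⇔ InD λ′ a b)))
    × (∀ h → sgnS s t ≢ + 0 ⇔ sgnS (act h s) (act h t) ≢ + 0)
    × (∀ w → InG s t w ⇔ InG t s (w ⁻¹))
    × (∀ π π′ → InG s t π → InG s t π′ → signG s t π ≡ signG s t π′)
    × (∀ π → InG s t π → signWord s * signG s t π * signWord t ≡ signPartition λ′)
mainTheorem11 m λ′ λ⊢m s t s∈A t∈A =
    ((h , G≡doubleCoset) , sgnS-doubleCoset s t)
  , (SgnNonzero-swap s∈A t∈A , SgnNonzero-conj⇔PairsFormD λ′ decreasing s t t∈A)
  , SgnNonzero-act⇔ s t
  , G⇔G⁻¹
  , signG-unique
  , f≡signPartition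
  where open ShapePair λ′ λ⊢m s t s∈A t∈A
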